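{- Let $A=(a_{ij})_{i,j\in I}$ be a generalized Cartan matrix with Kac–Moody algebra $\mathfrak{g}=\mathfrak{g}(A)$ and Weyl group $W$. Let $\Lambda\in P^+$ be a dominant integral weight and $K\in Z^+$. Let $U=U_{\Gamma_s(\Lambda)}$ and $D=D_{\Gamma_w(K)}$. Then $$DU-UD=\langle K,\Lambda\rangle\,\mathrm{Id}$$ as $\mathbb{Z}$-linear operators on $\mathbb{Z}W$; that is, $(\Gamma_s(\Lambda),\Gamma_w(K))$ is a pair of dual graded graphs with differential coefficient $r=\langle K,\Lambda\rangle$.
   Context: Let $\mathfrak{h}\subset\mathfrak{g}$ be the Cartan subalgebra (realization of minimal dimension, simple roots linearly independent), $\{\alpha_i\}\subset\mathfrak{h}^*$ the simple roots, $\{\alpha_i^\vee\}\subset\mathfrak{h}$ the simple coroots, $\{\Lambda_i\}$ the fundamental weights, $\langle\cdot,\cdot\rangle:\mathfrak{h}\times\mathfrak{h}^*\to\mathbb{C}$ the natural pairing with $a_{ij}=\langle\alpha_i^\vee,\alpha_j\rangle$. $W$ is generated by the simple reflections $s_i$; $\ell$ is the length function; $\Delta_{re}^+$ is the set of positive real roots; for $\alpha=u\alpha_i$ ($u\in W$) put $\alpha^\vee=u\alpha_i^\vee$ and $s_\alpha=us_iu^{ -1}$. The strong (Bruhat) order has covers $w\lessdot ws_\alpha$ whenever $\alpha\in\Delta_{re}^+$ and $\ell(ws_\alpha)=\ell(w)+1$; the left weak order has covers $w\prec s_iw$ whenever $\ell(s_iw)=\ell(w)+1$. $P^+$ is the set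 of dominant integral weights. $Z^+=Z(\mathfrak{g})\cap\bigoplus_{i\in I}\mathbb{Z}_{\ge0}\alpha_i^\vee$, where $Z(\mathfrak{g})$ is the center; write $K=\sum_i k_i\alpha_i^\vee$. A graded graph is a set $V$ with a grading $h:V\to\mathbb{Z}_{\ge0}$ and directed edges $(v,w)$ with $h(w)=h(v)+1$ carrying multiplicities $m(v,w)\in\mathbb{Z}_{\ge0}$; its up and down operators on the free abelian group $\mathbb{Z}V$ are $U(v)=\sum_{(v,w)}m(v,w)w$ and $D(w)=\sum_{(v,w)}m(v,w)v$. Two graded graphs $\Gamma,\Gamma'$ on the same graded vertex set are called dual with differential coefficient $r$ if $D_{\Gamma'}U_\Gamma-U_\Gamma D_{\Gamma'}=r\,\mathrm{Id}$. $\Gamma_s(\Lambda)$ is the graded graph with vertex set $W$, grading $\ell$, and an edge $(v,w)$ for each strong cover $v\lessdot w=vs_\alpha$, of multiplicity $\langle\alpha^\vee,\Lambda\rangle$. $\Gamma_w(K)$ is the graded graph with vertex set $W$, grading $\ell$, and an edge $(v,s_iv)$ for each left weak cover $v\prec s_iv$, of multiplicity $k_i=\langle K,\Lambda_i\rangle$. -}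

module Defs where

open import Data.Nat as ℕ using (ℕ; zero; suc)
open import Data.Integer as ℤ using (ℤ; +_; _+_; _*_; _-_)
open import Data.Fin using (Fin)
open import Data.Fin.Properties using (all?) renaming (_≟_ to _≟ᶠ_)
open import Data.List as List using (List; []; _∷_; _++_; reverse; allFin; concatMap; deduplicate; filter)
open import Data.Bool.ListAction using (any)
open import Data.Bool using (Bool; true; false; if_then_else_; _∧_)
open import Data.Product using (Σ; _×_)
open import Data.Sum using (_⊎_)
open import Relation.Nullary using (¬_; Dec; does)
open import Relation.Binary.PropositionalEquality using (_≡_; _≢_)

sumℤ : List ℤ → ℤ
sumℤ = List.foldr _+_ (+ 0)

Σ[_]_ : (n : ℕ) → (Fin n → ℤ) → ℤ
Σ[ n ] f = sumℤ (List.map f (allFin n))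

record GCM (n : ℕ) : Set where
  field
    a       : Fin n → Fin n → ℤ                 -- a i j = ⟨α_i^∨ , α_j⟩
    diag    : ∀ i → a i i ≡ + 2
    offdiag : ∀ i j → i ≢ j → a i j ℤ.≤ + 0
    zeroSym : ∀ i j → a i j ≡ + 0 → a j i ≡ + 0

δ : ∀ {n} → Fin n → Fin n → ℤ
δ i k = if does (i ≟ᶠ k) then + 1 else + 0

-- Words in the simple reflections; the word i₁ ∷ … ∷ iₘ ∷ [] stands for s_{i₁} ⋯ s_{iₘ}.
Word : ℕ → Set
Word n = List (Fin n)

module _ {n : ℕ} (A : GCM n) where
  open GCM A

  -- coordinates w.r.t. simple roots (root lattice Q) resp. simple coroots (Q^∨)
  -- ⟨α_j^∨ , β⟩ for β = Σ β_k α_k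
  pairRoot : Fin n → (Fin n → ℤ) → ℤ
  pairRoot j β = Σ[ n ] (λ k → a j k * β k)

  -- ⟨h , α_j⟩ for h = Σ h_k α_k^∨
  pairCoroot : (Fin n → ℤ) → Fin n → ℤ
  pairCoroot h j = Σ[ n ] (λ k → h k * a k j)

  sRoot : Fin n → (Fin n → ℤ) → (Fin n → ℤ)
  sRoot j β k = β k - pairRoot j β * δ j k

  sCoroot : Fin n → (Fin n → ℤ) → (Fin n → ℤ)
  sCoroot j h k = h k - pairCoroot h j * δ j k

  actRoot : Word n → (Fin n → ℤ) → (Fin n → ℤ)
  actRoot []      β = β
  actRoot (j ∷ w) β = sRoot j (actRoot w β)

  actCoroot : Word n → (Fin n → ℤ) → (Fin n → ℤ)
  actCoroot []      h = h
  actCoroot (j ∷ w) h = sCoroot j (actCoroot w h)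

  -- equality in W (W acts faithfully on the root lattice)
  _≈_ : Word n → Word n → Set
  v ≈ w = ∀ j k → actRoot v (δ j) k ≡ actRoot w (δ j) k

  _≈?_ : (v w : Word n) → Dec (v ≈ w)
  v ≈? w = all? (λ j → all? (λ k → actRoot v (δ j) k ℤ.≟ actRoot w (δ j) k))

  allWords : ℕ → List (Word n)
  allWords zero    = [] ∷ []
  allWords (suc m) = concatMap (λ w → List.map (_∷ w) (allFin n)) (allWords m)

  -- length function ℓ : minimal length of a word representing the same element
  len : Word n → ℕ
  len w = go 0 (List.length w)
    where
    go : ℕ → ℕ → ℕ
    go k zero    = k
    go k (suc f) = if any (λ u → does (u ≈? w)) (allWords k) then k else go (suc k) f

  elemsOfLength : ℕ → List (Word n)
  elemsOfLength m = deduplicate _≈?_ (filter (λ w → len w ℕ.≟ m) (allWords m))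

  elemsBelow : Word n → List (Word n)
  elemsBelow w with len w
  ... | zero  = []
  ... | suc m = elemsOfLength m

  -- Γ_s(Λ):  Λ ∈ P⁺ given by Λk = ⟨α_k^∨ , Λ⟩ ∈ ℕ.
  -- StrongEdge Λ v u m : v ⋖ u = v s_α with α = x α_i ∈ Δ⁺_re, and
  -- m = ⟨α^∨ , Λ⟩ where α^∨ = x α_i^∨.
  StrongEdge : (Fin n → ℕ) → Word n → Word n → ℤ → Set
  StrongEdge Λ v u m =
    len u ≡ suc (len v) ×
    Σ (Word n) λ x → Σ (Fin n) λ i →
      (u ≈ (v ++ (x ++ (i ∷ reverse x)))) ×
      (∀ k → + 0 ℤ.≤ actRoot x (δ i) k) ×
      (m ≡ Σ[ n ] (λ k → actCoroot x (δ i) k * + (Λ k)))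

  IsStrongMult : (Fin n → ℕ) → (Word n → Word n → ℤ) → Set
  IsStrongMult Λ mS = ∀ v u →
    StrongEdge Λ v u (mS v u) ⊎ ((¬ Σ ℤ (StrongEdge Λ v u)) × mS v u ≡ + 0)

  -- Γ_w(K): edge (v , s_i v) when ℓ(s_i v) = ℓ(v)+1, multiplicity k_i
  weakMult : (Fin n → ℕ) → Word n → Word n → ℤ
  weakMult K v u = Σ[ n ] (λ i →
    if does (u ≈? (i ∷ v)) ∧ does (len (i ∷ v) ℕ.≟ suc (len v)) then + (K i) else + 0)

  -- coefficient of w in (D U)(v) and (U D)(v)
  coefDU : (Word n → Word n → ℤ) → (Fin n → ℕ) → Word n → Word n → ℤ
  coefDU mS K v w = sumℤ (List.map (λ u → mS v u * weakMult K w u) (elemsOfLength (suc (len v))))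

  coefUD : (Word n → Word n → ℤ) → (Fin n → ℕ) → Word n → Word n → ℤ
  coefUD mS K v w = sumℤ (List.map (λ u → weakMult K u v * mS u w) (elemsBelow v))

  -- K = Σ k_i α_i^∨ is central: ⟨K , α_j⟩ = 0 for all j
  IsCentral : (Fin n → ℕ) → Set
  IsCentral K = ∀ j → Σ[ n ] (λ i → + (K i) * a i j) ≡ + 0

  pairKΛ : (Fin n → ℕ) → (Fin n → ℕ) → ℤ
  pairKΛ K Λ = Σ[ n ] (λ i → + (K i) * + (Λ i))

  idCoef : Word n → Word n → ℤ
  idCoef v w = if does (v ≈? w) then + 1 else + 0

-- The (v , w) entry of D U − U D only involves left multiplications: the weak down-edges of w are
-- w → s_i w, so it equals Σ_i k_i (m(v , s_i w) [s_i w > w] − [s_i v < v] m(s_i v , w)), with m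
-- the strong multiplicity. For v ≠ w every summand vanishes: if s_i w > w and s_i v < v the
-- strong edges v ⋖ s_i w and s_i v ⋖ w correspond to each other with the same reflection, and in
-- the other cases the lifting property (exchange condition) rules both out. For v = w the i-th
-- summand is k_i ⟨v⁻¹ α_i^∨ , Λ⟩ whether s_i v > v or s_i v < v, and Σ_i k_i v⁻¹ α_i^∨ = v⁻¹ K = K
-- because K is central.
module Submission where

open import Defs
open import Data.Nat as ℕ using (ℕ; zero; suc; _≤_; _<_; z≤n; s≤s; _∸_)
import Data.Nat.Properties as ℕP
open import Data.Nat.Induction using (<-rec)
open import Data.Integer as ℤ using (ℤ; +_; _+_; _*_; _-_; -_; +≤+; -[1+_]; -1ℤ; ∣_∣)
import Data.Integer.Properties as ℤP
open import Data.Integer.Solver using (module +-*-Solver)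
open import Data.Fin using (Fin; toℕ; fromℕ<) renaming (zero to fz; suc to fs)
open import Data.Fin.Properties using (all?; toℕ-fromℕ<) renaming (_≟_ to _≟ᶠ_)
open import Data.Vec.Functional using (Vector)
open import Data.List as List using (List; []; _∷_; _++_; reverse; [_]; length; filter; deduplicate)
import Data.List.Properties as LP
open import Data.List.Relation.Unary.Any using (Any; here; there)
import Data.List.Relation.Unary.Any.Properties as AnyP
import Data.List.Relation.Unary.All as All
import Data.List.Relation.Unary.All.Properties as AllP
open import Data.List.Relation.Unary.AllPairs using (AllPairs; []; _∷_)
import Data.List.Relation.Unary.AllPairs.Properties as APP
open import Data.List.Membership.Propositional using (_∈_)
open import Data.List.Membership.Propositional.Properties using (∈-filter⁺; ∈-filter⁻)
open import Data.Bool as Bool using (Bool; true; false; not; if_then_else_; _∧_)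
import Data.Bool.Properties as BP
open import Data.Bool.ListAction using (any)
open import Data.Product using (Σ; _×_; _,_; proj₁; proj₂)
open import Data.Product.Properties using () renaming (≡-dec to ×-≡-dec)
open import Data.Sum using (_⊎_; inj₁; inj₂)
open import Data.Unit using (⊤; tt)
open import Data.Empty using (⊥; ⊥-elim)
open import Function using (_∘_; id)
open import Function.Bundles using (Equivalence)
open import Relation.Nullary using (¬_; Dec; does; yes; no; ¬?)
open import Relation.Nullary.Decidable using (dec-true; dec-false; True; toWitness; _×-dec_)
open import Relation.Binary using (tri<; tri≈; tri>)
open import Relation.Binary.Bundles using (Setoid)
open import Relation.Binary.Structures using (IsEquivalence)
import Relation.Binary.Reasoning.Setoid as SetoidReasoning
open import Relation.Binary.PropositionalEquality hiding ([_])
open import Algebra.Properties.Semiring.Sum ℤP.+-*-semiring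
  using (sum; sum-cong-≗; sum-replicate-zero; ∑-distrib-+; ∑-comm; *-distribˡ-sum)

open +-*-Solver

Σ-suc : ∀ {n} (f : Fin (suc n) → ℤ) → Σ[ suc n ] f ≡ f fz + Σ[ n ] (f ∘ fs)
Σ-suc f = cong (λ xs → f fz + sumℤ xs)
  (trans (LP.map-tabulate fs f) (sym (LP.map-tabulate id (f ∘ fs))))

Σ≡sum : ∀ {n} (f : Fin n → ℤ) → Σ[ n ] f ≡ sum f
Σ≡sum {zero} f = refl
Σ≡sum {suc n} f = trans (Σ-suc f) (cong (_+_ (f fz)) (Σ≡sum (f ∘ fs)))

Σ-cong : ∀ {n} {f g : Fin n → ℤ} → f ≗ g → Σ[ n ] f ≡ Σ[ n ] g
Σ-cong {f = f} {g} f≗g = trans (Σ≡sum f) (trans (sum-cong-≗ f≗g) (sym (Σ≡sum g)))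

Σ-zero : ∀ n → Σ[ n ] (λ _ → + 0) ≡ + 0
Σ-zero n = trans (Σ≡sum {n} (λ _ → + 0)) (sum-replicate-zero n)

Σ-distrib-+ : ∀ {n} (f g : Fin n → ℤ) → Σ[ n ] (λ k → f k + g k) ≡ Σ[ n ] f + Σ[ n ] g
Σ-distrib-+ f g = trans (Σ≡sum (λ k → f k + g k)) (trans (∑-distrib-+ f g) (sym (cong₂ _+_ (Σ≡sum f) (Σ≡sum g))))

Σ-*ˡ : ∀ {n} (c : ℤ) (f : Fin n → ℤ) → Σ[ n ] (λ k → c * f k) ≡ c * Σ[ n ] f
Σ-*ˡ c f = trans (Σ≡sum (λ k → c * f k)) (trans (sym (*-distribˡ-sum c f)) (cong (c *_) (sym (Σ≡sum f))))

Σ-*ʳ : ∀ {n} (c : ℤ) (f : Fin n → ℤ) → Σ[ n ] (λ k → f k * c) ≡ Σ[ n ] f * c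
Σ-*ʳ c f = trans (Σ-cong (λ k → ℤP.*-comm (f k) c)) (trans (Σ-*ˡ c f) (ℤP.*-comm c _))

Σ-neg : ∀ {n} (f : Fin n → ℤ) → Σ[ n ] (λ k → - f k) ≡ - Σ[ n ] f
Σ-neg f = trans (Σ-cong (λ k → sym (ℤP.-1*i≡-i (f k)))) (trans (Σ-*ˡ -[1+ 0 ] f) (ℤP.-1*i≡-i _))

Σ-distrib-- : ∀ {n} (f g : Fin n → ℤ) → Σ[ n ] (λ k → f k - g k) ≡ Σ[ n ] f - Σ[ n ] g
Σ-distrib-- f g = trans (Σ-distrib-+ f (λ k → - g k)) (cong (_+_ (Σ[ _ ] f)) (Σ-neg g))

Σ-comm : ∀ {n m} (f : Fin n → Fin m → ℤ) →
         Σ[ n ] (λ i → Σ[ m ] (f i)) ≡ Σ[ m ] (λ k → Σ[ n ] (λ i → f i k))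
Σ-comm {n} {m} f = begin
  Σ[ n ] (λ i → Σ[ m ] (f i))        ≡⟨ trans (Σ-cong (Σ≡sum ∘ f)) (Σ≡sum (λ i → sum (f i))) ⟩
  sum (λ i → sum (f i))              ≡⟨ ∑-comm f ⟩
  sum (λ k → sum (λ i → f i k))      ≡⟨ sym (trans (Σ-cong (λ k → Σ≡sum (λ i → f i k))) (Σ≡sum (λ k → sum (λ i → f i k)))) ⟩
  Σ[ m ] (λ k → Σ[ n ] (λ i → f i k)) ∎
  where open ≡-Reasoning

δ-refl : ∀ {n} (j : Fin n) → δ j j ≡ + 1
δ-refl j = cong (if_then + 1 else + 0) (dec-true (j ≟ᶠ j) refl)

δ-≢ : ∀ {n} {j k : Fin n} → j ≢ k → δ j k ≡ + 0
δ-≢ {j = j} {k} j≢k = cong (if_then + 1 else + 0) (dec-false (j ≟ᶠ k) j≢k)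

δ-sym : ∀ {n} (j k : Fin n) → δ j k ≡ δ k j
δ-sym j k with j ≟ᶠ k
... | yes refl = sym (δ-refl j)
... | no j≢k = sym (δ-≢ (j≢k ∘ sym))

Σ-δʳ : ∀ {n} (j : Fin n) (f : Fin n → ℤ) → Σ[ n ] (λ k → f k * δ j k) ≡ f j
Σ-δʳ {suc n} fz f = begin
  Σ[ suc n ] (λ k → f k * δ fz k)             ≡⟨ Σ-suc (λ k → f k * δ fz k) ⟩
  f fz * + 1 + Σ[ n ] (λ k → f (fs k) * + 0)  ≡⟨ cong₂ _+_ (ℤP.*-identityʳ (f fz)) (Σ-cong (ℤP.*-zeroʳ ∘ f ∘ fs)) ⟩
  f fz + Σ[ n ] (λ _ → + 0)                   ≡⟨ trans (cong (_+_ (f fz)) (Σ-zero n)) (ℤP.+-identityʳ _) ⟩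
  f fz                                        ∎
  where open ≡-Reasoning
Σ-δʳ {suc n} (fs j) f = begin
  Σ[ suc n ] (λ k → f k * δ (fs j) k)             ≡⟨ Σ-suc (λ k → f k * δ (fs j) k) ⟩
  f fz * + 0 + Σ[ n ] (λ k → f (fs k) * δ j k)    ≡⟨ cong (_+ Σ[ n ] (λ k → f (fs k) * δ j k)) (ℤP.*-zeroʳ (f fz)) ⟩
  + 0 + Σ[ n ] (λ k → f (fs k) * δ j k)           ≡⟨ ℤP.+-identityˡ _ ⟩
  Σ[ n ] (λ k → f (fs k) * δ j k)                 ≡⟨ Σ-δʳ j (f ∘ fs) ⟩
  f (fs j)                                        ∎
  where open ≡-Reasoning

Σ-δˡ : ∀ {n} (j : Fin n) (f : Fin n → ℤ) → Σ[ n ] (λ k → δ j k * f k) ≡ f j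
Σ-δˡ j f = trans (Σ-cong (λ k → ℤP.*-comm (δ j k) (f k))) (Σ-δʳ j f)

Pos Neg : ∀ {n} → Vector ℤ n → Set
Pos β = ∀ k → + 0 ℤ.≤ β k
Neg β = ∀ k → β k ℤ.≤ + 0

δ-nonneg : ∀ {n} (j k : Fin n) → + 0 ℤ.≤ δ j k
δ-nonneg j k with j ≟ᶠ k
... | yes _ = +≤+ z≤n
... | no _ = +≤+ z≤n

nonneg-* : ∀ {x y} → + 0 ℤ.≤ x → + 0 ℤ.≤ y → + 0 ℤ.≤ x * y
nonneg-* {+ m} {+ n} _ _ = subst (+ 0 ℤ.≤_) (ℤP.pos-* m n) (+≤+ z≤n)

nonneg-+ : ∀ {x y} → + 0 ℤ.≤ x → + 0 ℤ.≤ y → + 0 ℤ.≤ x + y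
nonneg-+ = ℤP.+-mono-≤

neg-nonneg⇒nonpos : ∀ {x} → + 0 ℤ.≤ - x → x ℤ.≤ + 0
neg-nonneg⇒nonpos {x} h = subst (ℤ._≤ + 0) (ℤP.neg-involutive x) (ℤP.neg-mono-≤ h)

infixl 6 _+ᵛ_
infixl 7 _·ᵛ_

_+ᵛ_ : ∀ {n} → Vector ℤ n → Vector ℤ n → Vector ℤ n
(β +ᵛ γ) k = β k + γ k

_·ᵛ_ : ∀ {n} → ℤ → Vector ℤ n → Vector ℤ n
(c ·ᵛ β) k = c * β k

0ᵛ : ∀ {n} → Vector ℤ n
0ᵛ k = + 0

Σᵛ : ∀ {n} → (Fin n → Vector ℤ n) → Vector ℤ n
Σᵛ {n} F k = Σ[ n ] (λ m → F m k)

transpose : ∀ {n} → GCM n → GCM n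
transpose A = record
  { a = λ i j → GCM.a A j i
  ; diag = GCM.diag A
  ; offdiag = λ i j i≢j → GCM.offdiag A j i (i≢j ∘ sym)
  ; zeroSym = λ i j → GCM.zeroSym A j i
  }

reflWord : ∀ {n} → Word n → Fin n → Word n
reflWord x j = x ++ j ∷ reverse x

module Action {n : ℕ} (A : GCM n) where
  open GCM A

  act : Word n → Vector ℤ n → Vector ℤ n
  act = actRoot A

  pair : Fin n → Vector ℤ n → ℤ
  pair = pairRoot A

  reflect : Fin n → Vector ℤ n → Vector ℤ n
  reflect = sRoot A

  pair-cong : ∀ j {β γ} → β ≗ γ → pair j β ≡ pair j γ
  pair-cong j β≗γ = Σ-cong (λ k → cong (a j k *_) (β≗γ k))

  pair-+ : ∀ j β γ → pair j (β +ᵛ γ) ≡ pair j β + pair j γ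
  pair-+ j β γ = trans (Σ-cong (λ k → ℤP.*-distribˡ-+ (a j k) (β k) (γ k))) (Σ-distrib-+ (λ k → a j k * β k) (λ k → a j k * γ k))

  pair-· : ∀ j c β → pair j (c ·ᵛ β) ≡ c * pair j β
  pair-· j c β = trans (Σ-cong (λ k → solve 3 (λ x y z → x :* (y :* z) := y :* (x :* z)) refl (a j k) c (β k)))
                       (Σ-*ˡ c (λ k → a j k * β k))

  pair-δ : ∀ j m → pair j (δ m) ≡ a j m
  pair-δ j m = Σ-δʳ m (a j)

  pair-0ᵛ : ∀ j → pair j 0ᵛ ≡ + 0
  pair-0ᵛ j = trans (Σ-cong (ℤP.*-zeroʳ ∘ a j)) (Σ-zero n)

  pair-Σᵛ : ∀ i F → pair i (Σᵛ F) ≡ Σ[ n ] (λ m → pair i (F m))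
  pair-Σᵛ i F = trans (Σ-cong (λ k → sym (Σ-*ˡ (a i k) (λ m → F m k)))) (Σ-comm (λ k m → a i k * F m k))

  reflect-cong : ∀ j {β γ} → β ≗ γ → reflect j β ≗ reflect j γ
  reflect-cong j β≗γ k = cong₂ _-_ (β≗γ k) (cong (_* δ j k) (pair-cong j β≗γ))

  reflect-+ : ∀ j β γ → reflect j (β +ᵛ γ) ≗ reflect j β +ᵛ reflect j γ
  reflect-+ j β γ k = begin
      (β k + γ k) - pair j (β +ᵛ γ) * δ j k
    ≡⟨ cong (λ t → (β k + γ k) - t * δ j k) (pair-+ j β γ) ⟩
      (β k + γ k) - (pair j β + pair j γ) * δ j k
    ≡⟨ solve 5 (λ b g p q d → (b :+ g) :- (p :+ q) :* d := (b :- p :* d) :+ (g :- q :* d))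
               refl (β k) (γ k) (pair j β) (pair j γ) (δ j k) ⟩
      (β k - pair j β * δ j k) + (γ k - pair j γ * δ j k)
    ∎ where open ≡-Reasoning

  reflect-· : ∀ j c β → reflect j (c ·ᵛ β) ≗ c ·ᵛ reflect j β
  reflect-· j c β k = begin
      c * β k - pair j (c ·ᵛ β) * δ j k
    ≡⟨ cong (λ t → c * β k - t * δ j k) (pair-· j c β) ⟩
      c * β k - (c * pair j β) * δ j k
    ≡⟨ solve 4 (λ c b p d → c :* b :- (c :* p) :* d := c :* (b :- p :* d)) refl c (β k) (pair j β) (δ j k) ⟩
      c * (β k - pair j β * δ j k)
    ∎ where open ≡-Reasoning

  reflect-Σᵛ : ∀ i F → reflect i (Σᵛ F) ≗ Σᵛ (λ m → reflect i (F m))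
  reflect-Σᵛ i F k = begin
      Σ[ n ] (λ m → F m k) - pair i (Σᵛ F) * δ i k
    ≡⟨ cong (λ t → Σ[ n ] (λ m → F m k) - t * δ i k) (pair-Σᵛ i F) ⟩
      Σ[ n ] (λ m → F m k) - Σ[ n ] (λ m → pair i (F m)) * δ i k
    ≡⟨ cong (_-_ (Σ[ n ] (λ m → F m k))) (sym (Σ-*ʳ (δ i k) (λ m → pair i (F m)))) ⟩
      Σ[ n ] (λ m → F m k) - Σ[ n ] (λ m → pair i (F m) * δ i k)
    ≡⟨ sym (Σ-distrib-- (λ m → F m k) (λ m → pair i (F m) * δ i k)) ⟩
      Σ[ n ] (λ m → F m k - pair i (F m) * δ i k)
    ∎ where open ≡-Reasoning

  reflect-as-+ : ∀ i μ → reflect i μ ≗ μ +ᵛ (- pair i μ) ·ᵛ δ i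
  reflect-as-+ i μ k = solve 3 (λ b p d → b :- p :* d := b :+ (:- p) :* d) refl (μ k) (pair i μ) (δ i k)

  pair-reflect : ∀ k i μ → pair k (reflect i μ) ≡ pair k μ - pair i μ * a k i
  pair-reflect k i μ = begin
      pair k (reflect i μ)
    ≡⟨ pair-cong k (reflect-as-+ i μ) ⟩
      pair k (μ +ᵛ (- pair i μ) ·ᵛ δ i)
    ≡⟨ pair-+ k μ _ ⟩
      pair k μ + pair k ((- pair i μ) ·ᵛ δ i)
    ≡⟨ cong (_+_ (pair k μ)) (trans (pair-· k (- pair i μ) (δ i)) (cong ((- pair i μ) *_) (pair-δ k i))) ⟩
      pair k μ + (- pair i μ) * a k i
    ≡⟨ solve 3 (λ x p y → x :+ (:- p) :* y := x :- p :* y) refl (pair k μ) (pair i μ) (a k i) ⟩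
      pair k μ - pair i μ * a k i
    ∎ where open ≡-Reasoning

  reflect-involutive : ∀ j β → reflect j (reflect j β) ≗ β
  reflect-involutive j β k = begin
      (β k - pair j β * δ j k) - pair j (reflect j β) * δ j k
    ≡⟨ cong (λ t → (β k - pair j β * δ j k) - t * δ j k)
            (trans (pair-reflect j j β) (cong (λ t → pair j β - pair j β * t) (diag j))) ⟩
      (β k - pair j β * δ j k) - (pair j β - pair j β * + 2) * δ j k
    ≡⟨ solve 3 (λ b p d → (b :- p :* d) :- (p :- p :* con (+ 2)) :* d := b) refl (β k) (pair j β) (δ j k) ⟩
      β k
    ∎ where open ≡-Reasoning

  reflect-δ : ∀ j → reflect j (δ j) ≗ -1ℤ ·ᵛ δ j
  reflect-δ j k = begin
      δ j k - pair j (δ j) * δ j k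
    ≡⟨ cong (λ t → δ j k - t * δ j k) (trans (pair-δ j j) (diag j)) ⟩
      δ j k - + 2 * δ j k
    ≡⟨ solve 1 (λ d → d :- con (+ 2) :* d := con -1ℤ :* d) refl (δ j k) ⟩
      -1ℤ * δ j k
    ∎ where open ≡-Reasoning

  act-cong : ∀ w {β γ} → β ≗ γ → act w β ≗ act w γ
  act-cong [] β≗γ = β≗γ
  act-cong (i ∷ w) β≗γ = reflect-cong i (act-cong w β≗γ)

  act-++ : ∀ x y β → act (x ++ y) β ≗ act x (act y β)
  act-++ [] y β k = refl
  act-++ (i ∷ x) y β = reflect-cong i (act-++ x y β)

  act-+ : ∀ w β γ → act w (β +ᵛ γ) ≗ act w β +ᵛ act w γ
  act-+ [] β γ k = refl
  act-+ (i ∷ w) β γ k = trans (reflect-cong i (act-+ w β γ) k) (reflect-+ i (act w β) (act w γ) k)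

  act-· : ∀ w c β → act w (c ·ᵛ β) ≗ c ·ᵛ act w β
  act-· [] c β k = refl
  act-· (i ∷ w) c β k = trans (reflect-cong i (act-· w c β) k) (reflect-· i c (act w β) k)

  act-0ᵛ : ∀ w → act w 0ᵛ ≗ 0ᵛ
  act-0ᵛ [] k = refl
  act-0ᵛ (i ∷ w) k = trans (reflect-cong i (act-0ᵛ w) k) (cong (λ t → + 0 - t * δ i k) (pair-0ᵛ i))

  act-Σᵛ : ∀ w F → act w (Σᵛ F) ≗ Σᵛ (λ m → act w (F m))
  act-Σᵛ [] F k = refl
  act-Σᵛ (i ∷ w) F k = trans (reflect-cong i (act-Σᵛ w F) k) (reflect-Σᵛ i (λ m → act w (F m)) k)

  act-linear : ∀ w β → act w β ≗ Σᵛ (λ m → β m ·ᵛ act w (δ m))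
  act-linear w β k = begin
      act w β k
    ≡⟨ act-cong w (λ k′ → sym (trans (Σ-cong (λ m → cong (β m *_) (δ-sym m k′))) (Σ-δʳ k′ β))) k ⟩
      act w (Σᵛ (λ m → β m ·ᵛ δ m)) k
    ≡⟨ act-Σᵛ w (λ m → β m ·ᵛ δ m) k ⟩
      Σ[ n ] (λ m → act w (β m ·ᵛ δ m) k)
    ≡⟨ Σ-cong (λ m → act-· w (β m) (δ m) k) ⟩
      Σ[ n ] (λ m → β m * act w (δ m) k)
    ∎ where open ≡-Reasoning

  act-reverse-act : ∀ w β → act (reverse w) (act w β) ≗ β
  act-reverse-act [] β k = refl
  act-reverse-act (i ∷ w) β k = begin
      act (reverse (i ∷ w)) (act (i ∷ w) β) k
    ≡⟨ cong (λ x → act x (act (i ∷ w) β) k) (LP.unfold-reverse i w) ⟩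
      act (reverse w ++ [ i ]) (reflect i (act w β)) k
    ≡⟨ act-++ (reverse w) [ i ] _ k ⟩
      act (reverse w) (reflect i (reflect i (act w β))) k
    ≡⟨ act-cong (reverse w) (reflect-involutive i (act w β)) k ⟩
      act (reverse w) (act w β) k
    ≡⟨ act-reverse-act w β k ⟩
      β k
    ∎ where open ≡-Reasoning

  act-act-reverse : ∀ w β → act w (act (reverse w) β) ≗ β
  act-act-reverse w β k = trans (cong (λ x → act x (act (reverse w) β) k) (sym (LP.reverse-involutive w)))
                                (act-reverse-act (reverse w) β k)

  act-snoc-δ : ∀ w j → act (w ++ [ j ]) (δ j) ≗ -1ℤ ·ᵛ act w (δ j)
  act-snoc-δ w j k = trans (act-++ w [ j ] (δ j) k) (trans (act-cong w (reflect-δ j) k) (act-· w -1ℤ (δ j) k))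

  act-δ-nonzero : ∀ w j → ¬ (act w (δ j) ≗ 0ᵛ)
  act-δ-nonzero w j w·αⱼ≗0 = 0≢1 (begin
      + 0                                       ≡⟨ sym (act-0ᵛ (reverse w) j) ⟩
      act (reverse w) 0ᵛ j                      ≡⟨ act-cong (reverse w) (sym ∘ w·αⱼ≗0) j ⟩
      act (reverse w) (act w (δ j)) j           ≡⟨ act-reverse-act w (δ j) j ⟩
      δ j j                                     ≡⟨ δ-refl j ⟩
      + 1                                       ∎)
    where
    open ≡-Reasoning
    0≢1 : + 0 ≢ + 1
    0≢1 ()

  root-not-Pos-and-Neg : ∀ w j → Pos (act w (δ j)) → Neg (act w (δ j)) → ⊥
  root-not-Pos-and-Neg w j Pos Neg = act-δ-nonzero w j (λ k → ℤP.≤-antisym (Neg k) (Pos k))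

  pairing : Vector ℤ n → Vector ℤ n → ℤ
  pairing h μ = Σ[ n ] (λ k → h k * pair k μ)

  pairing-congˡ : ∀ {h h′} μ → h ≗ h′ → pairing h μ ≡ pairing h′ μ
  pairing-congˡ μ h≗h′ = Σ-cong (λ k → cong (_* pair k μ) (h≗h′ k))

  pairing-δ : ∀ j μ → pairing (δ j) μ ≡ pair j μ
  pairing-δ j μ = Σ-δˡ j (λ k → pair k μ)

  pairing-sCoroot : ∀ i h μ → pairing (sCoroot A i h) μ ≡ pairing h (reflect i μ)
  pairing-sCoroot i h μ = trans lhs (sym rhs)
    where
    q = pairCoroot A h i
    lhs : pairing (sCoroot A i h) μ ≡ pairing h μ - q * pair i μ
    lhs = begin
        Σ[ n ] (λ k → (h k - q * δ i k) * pair k μ)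
      ≡⟨ Σ-cong (λ k → solve 4 (λ x q d p → (x :- q :* d) :* p := x :* p :- q :* (d :* p)) refl (h k) q (δ i k) (pair k μ)) ⟩
        Σ[ n ] (λ k → h k * pair k μ - q * (δ i k * pair k μ))
      ≡⟨ Σ-distrib-- (λ k → h k * pair k μ) (λ k → q * (δ i k * pair k μ)) ⟩
        pairing h μ - Σ[ n ] (λ k → q * (δ i k * pair k μ))
      ≡⟨ cong (_-_ (pairing h μ)) (trans (Σ-*ˡ q (λ k → δ i k * pair k μ)) (cong (q *_) (pairing-δ i μ))) ⟩
        pairing h μ - q * pair i μ
      ∎ where open ≡-Reasoning
    rhs : pairing h (reflect i μ) ≡ pairing h μ - q * pair i μ
    rhs = begin
        Σ[ n ] (λ k → h k * pair k (reflect i μ))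
      ≡⟨ Σ-cong (λ k → trans (cong (h k *_) (pair-reflect k i μ))
           (solve 4 (λ x P p y → x :* (P :- p :* y) := x :* P :- p :* (x :* y)) refl (h k) (pair k μ) (pair i μ) (a k i))) ⟩
        Σ[ n ] (λ k → h k * pair k μ - pair i μ * (h k * a k i))
      ≡⟨ Σ-distrib-- (λ k → h k * pair k μ) (λ k → pair i μ * (h k * a k i)) ⟩
        pairing h μ - Σ[ n ] (λ k → pair i μ * (h k * a k i))
      ≡⟨ cong (_-_ (pairing h μ)) (trans (Σ-*ˡ (pair i μ) (λ k → h k * a k i)) (ℤP.*-comm (pair i μ) q)) ⟩
        pairing h μ - q * pair i μ
      ∎ where open ≡-Reasoning

  act-reflWord : ∀ x j μ → act (reflWord x j) μ ≗ μ +ᵛ (- pairing (actCoroot A x (δ j)) μ) ·ᵛ act x (δ j)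
  act-reflWord [] j μ k = trans (reflect-as-+ j μ k) (cong (λ t → μ k + (- t) * δ j k) (sym (pairing-δ j μ)))
  act-reflWord (i ∷ x) j μ k = begin
      act (reflWord (i ∷ x) j) μ k
    ≡⟨ cong (λ w → act w μ k) reflWord-∷ ⟩
      reflect i (act (reflWord x j ++ [ i ]) μ) k
    ≡⟨ reflect-cong i (act-++ (reflWord x j) [ i ] μ) k ⟩
      reflect i (act (reflWord x j) (reflect i μ)) k
    ≡⟨ reflect-cong i (act-reflWord x j (reflect i μ)) k ⟩
      reflect i (reflect i μ +ᵛ (- c) ·ᵛ β) k
    ≡⟨ reflect-+ i (reflect i μ) ((- c) ·ᵛ β) k ⟩
      reflect i (reflect i μ) k + reflect i ((- c) ·ᵛ β) k
    ≡⟨ cong₂ _+_ (reflect-involutive i μ k) (reflect-· i (- c) β k) ⟩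
      μ k + (- c) * reflect i β k
    ≡⟨ cong (λ t → μ k + (- t) * reflect i β k) (sym (pairing-sCoroot i h μ)) ⟩
      μ k + (- pairing (sCoroot A i h) μ) * reflect i β k
    ∎ where
      open ≡-Reasoning
      h = actCoroot A x (δ j)
      β = act x (δ j)
      c = pairing h (reflect i μ)
      reflWord-∷ : reflWord (i ∷ x) j ≡ i ∷ (reflWord x j ++ [ i ])
      reflWord-∷ = cong (i ∷_) (trans (cong (λ r → x ++ j ∷ r) (LP.unfold-reverse i x))
                                      (sym (LP.++-assoc x (j ∷ reverse x) [ i ])))

snoc-decomp : ∀ {X : Set} (xs : List X) {m} → length xs ≡ suc m →
              Σ (List X) λ r → Σ X λ s → xs ≡ r ++ [ s ] × length r ≡ m
snoc-decomp (x ∷ []) {zero} _ = [] , x , refl , refl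
snoc-decomp (x ∷ y ∷ xs) {suc m} e with snoc-decomp (y ∷ xs) {m} (ℕP.suc-injective e)
... | r , s , eq , l = x ∷ r , s , cong (x ∷_) eq , cong suc l

module Weyl {n : ℕ} (A : GCM n) where
  open GCM A
  open Action A

  infix 4 _≃_
  record _≃_ (v w : Word n) : Set where
    constructor mk≃
    field un≃ : _≈_ A v w
  open _≃_ public

  ≃-act : ∀ {v w} → v ≃ w → ∀ β → act v β ≗ act w β
  ≃-act {v} {w} v≃w β k = begin
    act v β k                                 ≡⟨ act-linear v β k ⟩
    Σ[ n ] (λ m → β m * act v (δ m) k)        ≡⟨ Σ-cong (λ m → cong (β m *_) (un≃ v≃w m k)) ⟩
    Σ[ n ] (λ m → β m * act w (δ m) k)        ≡⟨ sym (act-linear w β k) ⟩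
    act w β k                                 ∎
    where open ≡-Reasoning

  ≃-refl : ∀ {v} → v ≃ v
  ≃-refl = mk≃ (λ j k → refl)

  ≃-sym : ∀ {v w} → v ≃ w → w ≃ v
  ≃-sym e = mk≃ (λ j k → sym (un≃ e j k))

  ≃-trans : ∀ {u v w} → u ≃ v → v ≃ w → u ≃ w
  ≃-trans e f = mk≃ (λ j k → trans (un≃ e j k) (un≃ f j k))

  ≈-isEquivalence : IsEquivalence (_≈_ A)
  ≈-isEquivalence = record
    { refl = λ j k → refl
    ; sym = λ e j k → sym (e j k)
    ; trans = λ e f j k → trans (e j k) (f j k)
    }

  ≃-setoid : Setoid _ _
  ≃-setoid = record
    { Carrier = Word n
    ; _≈_ = _≃_
    ; isEquivalence = record { refl = ≃-refl ; sym = ≃-sym ; trans = ≃-trans }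
    }

  module ≃-Reasoning = SetoidReasoning ≃-setoid

  ≃-++ : ∀ {x x′ y y′} → x ≃ x′ → y ≃ y′ → x ++ y ≃ x′ ++ y′
  ≃-++ {x} {x′} {y} {y′} x≃x′ y≃y′ = mk≃ λ j k → begin
      act (x ++ y) (δ j) k        ≡⟨ act-++ x y (δ j) k ⟩
      act x (act y (δ j)) k       ≡⟨ act-cong x (un≃ y≃y′ j) k ⟩
      act x (act y′ (δ j)) k      ≡⟨ ≃-act x≃x′ (act y′ (δ j)) k ⟩
      act x′ (act y′ (δ j)) k     ≡⟨ sym (act-++ x′ y′ (δ j) k) ⟩
      act (x′ ++ y′) (δ j) k      ∎
    where open ≡-Reasoning

  ≃-++ˡ : ∀ x {y y′} → y ≃ y′ → x ++ y ≃ x ++ y′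
  ≃-++ˡ x = ≃-++ (≃-refl {x})

  ≃-++ʳ : ∀ {x x′} y → x ≃ x′ → x ++ y ≃ x′ ++ y
  ≃-++ʳ y e = ≃-++ e (≃-refl {y})

  ≃-∷ : ∀ i {y y′} → y ≃ y′ → i ∷ y ≃ i ∷ y′
  ≃-∷ i = ≃-++ˡ [ i ]

  inverseʳ : ∀ x → x ++ reverse x ≃ []
  inverseʳ x = mk≃ λ j k → trans (act-++ x (reverse x) (δ j) k) (act-act-reverse x (δ j) k)

  inverseˡ : ∀ x → reverse x ++ x ≃ []
  inverseˡ x = mk≃ λ j k → trans (act-++ (reverse x) x (δ j) k) (act-reverse-act x (δ j) k)

  ii≃[] : ∀ i → i ∷ i ∷ [] ≃ []
  ii≃[] i = mk≃ λ j k → reflect-involutive i (δ j) k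

  ii∷≃ : ∀ i v → i ∷ i ∷ v ≃ v
  ii∷≃ i v = ≃-++ʳ v (ii≃[] i)

  snoc-snoc≃ : ∀ w s → (w ++ [ s ]) ++ [ s ] ≃ w
  snoc-snoc≃ w s = begin
    (w ++ [ s ]) ++ [ s ]    ≡⟨ LP.++-assoc w [ s ] [ s ] ⟩
    w ++ s ∷ s ∷ []          ≈⟨ ≃-++ˡ w (ii≃[] s) ⟩
    w ++ []                  ≡⟨ LP.++-identityʳ w ⟩
    w                        ∎
    where open ≃-Reasoning

  ++≃[]⇒≃reverse : ∀ x y → x ++ y ≃ [] → x ≃ reverse y
  ++≃[]⇒≃reverse x y xy≃[] = begin
    x                         ≡⟨ LP.++-identityʳ x ⟨
    x ++ []                   ≈⟨ ≃-++ˡ x (inverseʳ y) ⟨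
    x ++ (y ++ reverse y)     ≡⟨ LP.++-assoc x y (reverse y) ⟨
    (x ++ y) ++ reverse y     ≈⟨ ≃-++ʳ (reverse y) xy≃[] ⟩
    reverse y                 ∎
    where open ≃-Reasoning

  ≃-reverse : ∀ {x y} → x ≃ y → reverse x ≃ reverse y
  ≃-reverse {x} {y} x≃y = mk≃ λ j k → begin
      act (reverse x) (δ j) k
    ≡⟨ sym (act-reverse-act y (act (reverse x) (δ j)) k) ⟩
      act (reverse y) (act y (act (reverse x) (δ j))) k
    ≡⟨ act-cong (reverse y) (sym ∘ ≃-act x≃y (act (reverse x) (δ j))) k ⟩
      act (reverse y) (act x (act (reverse x) (δ j))) k
    ≡⟨ act-cong (reverse y) (act-act-reverse x (δ j)) k ⟩
      act (reverse y) (δ j) k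
    ∎ where open ≡-Reasoning

  ≃-cancelˡ : ∀ v {x y} → v ++ x ≃ v ++ y → x ≃ y
  ≃-cancelˡ v {x} {y} e = begin
    x                         ≡⟨ refl ⟩
    [] ++ x                   ≈⟨ ≃-++ʳ x (≃-sym (inverseˡ v)) ⟩
    (reverse v ++ v) ++ x     ≡⟨ LP.++-assoc (reverse v) v x ⟩
    reverse v ++ (v ++ x)     ≈⟨ ≃-++ˡ (reverse v) e ⟩
    reverse v ++ (v ++ y)     ≡⟨ LP.++-assoc (reverse v) v y ⟨
    (reverse v ++ v) ++ y     ≈⟨ ≃-++ʳ y (inverseˡ v) ⟩
    y                         ∎
    where open ≃-Reasoning

  ≃-cancel-∷ : ∀ i {x y} → i ∷ x ≃ i ∷ y → x ≃ y
  ≃-cancel-∷ i = ≃-cancelˡ [ i ]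

  allWords⁺ : ∀ {P : Word n → Set} u → P u → Any P (allWords A (length u))
  allWords⁺ [] p = here p
  allWords⁺ {P} (x ∷ u) p = AnyP.concatMap⁺ (λ w → List.map (_∷ w) (List.allFin n))
     (allWords⁺ {P = λ w → Any P (List.map (_∷ w) (List.allFin n))} u (AnyP.map⁺ (AnyP.tabulate⁺ x p)))

  allWords⁻ : ∀ {P : Word n → Set} k → Any P (allWords A k) → Σ (Word n) λ u → P u × length u ≡ k
  allWords⁻ zero (here p) = [] , p , refl
  allWords⁻ {P} (suc k) q with allWords⁻ {P = λ w → Any P (List.map (_∷ w) (List.allFin n))} k
                                 (AnyP.concatMap⁻ (λ w → List.map (_∷ w) (List.allFin n)) q)
  ... | u , pu , lu with AnyP.tabulate⁻ (AnyP.map⁻ pu)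
  ... | x , px = x ∷ u , px , cong suc lu

  T-does⇒ : ∀ {P : Set} (d : Dec P) → Bool.T (does d) → P
  T-does⇒ (yes p) _ = p

  ⇒T-does : ∀ {P : Set} (d : Dec P) → P → Bool.T (does d)
  ⇒T-does (yes _) _ = tt
  ⇒T-does (no ¬p) p = ¬p p

  representedAt : Word n → ℕ → Bool
  representedAt w k = any (λ u → does (_≈?_ A u w)) (allWords A k)

  representedAt-sound : ∀ w k → representedAt w k ≡ true → Σ (Word n) λ u → u ≃ w × length u ≡ k
  representedAt-sound w k e
    with allWords⁻ k (AnyP.any⁻ (λ u → does (_≈?_ A u w)) (allWords A k) (Equivalence.from BP.T-≡ e))
  ... | u , t , l = u , mk≃ (T-does⇒ (_≈?_ A u w) t) , l

  representedAt-complete : ∀ w u → u ≃ w → representedAt w (length u) ≡ true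
  representedAt-complete w u u≃w = Equivalence.to BP.T-≡
    (AnyP.any⁺ (λ u → does (_≈?_ A u w)) (allWords⁺ u (⇒T-does (_≈?_ A u w) (un≃ u≃w))))

  module _ (w : Word n) where
    search : ℕ → ℕ → ℕ
    search k zero = k
    search k (suc f) = if representedAt w k then k else search (suc k) f

    search-unique : (H : ℕ → ℕ → ℕ) → (∀ k → H k zero ≡ k) →
                    (∀ k f → H k (suc f) ≡ (if representedAt w k then k else H (suc k) f)) →
                    ∀ k f → H k f ≡ search k f
    search-unique H e₀ eₛ k zero = e₀ k
    search-unique H e₀ eₛ k (suc f) = trans (eₛ k f) (cong (if representedAt w k then k else_) (search-unique H e₀ eₛ (suc k) f))

    -- `len` runs a where-bound copy of `search`: abstracting its arguments lets unification
    -- solve the meta `lenLoop` with that copy.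
    mutual
      lenLoop : ℕ → ℕ → ℕ
      lenLoop = _

      len≡search : len A w ≡ search 0 (length w)
      len≡search with List.foldr (λ _ → suc) 0 w
      ... | m with 0
      ... | k = search-unique lenLoop (λ _ → refl) (λ _ _ → refl) k m

    IsLength : ℕ → Set
    IsLength r = (Σ (Word n) λ u → u ≃ w × length u ≡ r) × (∀ u → u ≃ w → r ≤ length u)

    search-isLength : ∀ k f → k ℕ.+ f ≡ length w → (∀ u → u ≃ w → k ≤ length u) → IsLength (search k f)
    search-isLength k zero e k≤ = (w , ≃-refl , trans (sym e) (ℕP.+-identityʳ k)) , k≤
    search-isLength k (suc f) e k≤ with representedAt w k in eq
    ... | true = representedAt-sound w k eq , k≤
    ... | false = search-isLength (suc k) f (trans (sym (ℕP.+-suc k f)) e) k<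
      where
      k< : ∀ u → u ≃ w → suc k ≤ length u
      k< u u≃w with ℕP.m≤n⇒m<n∨m≡n (k≤ u u≃w)
      ... | inj₁ lt = lt
      ... | inj₂ refl with () ← trans (sym (representedAt-complete w u u≃w)) eq

    len-isLength : IsLength (len A w)
    len-isLength = subst IsLength (sym len≡search) (search-isLength 0 (length w) refl (λ _ _ → z≤n))

  opaque
    red : Word n → Word n
    red w = proj₁ (proj₁ (len-isLength w))

    red-≃ : ∀ w → red w ≃ w
    red-≃ w = proj₁ (proj₂ (proj₁ (len-isLength w)))

    length-red : ∀ w → length (red w) ≡ len A w
    length-red w = proj₂ (proj₂ (proj₁ (len-isLength w)))

    len-minimal : ∀ {u w} → u ≃ w → len A w ≤ length u
    len-minimal {u} {w} = proj₂ (len-isLength w) u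

  ℓ : Word n → ℕ
  ℓ = len A

  ℓ-cong : ∀ {v w} → v ≃ w → ℓ v ≡ ℓ w
  ℓ-cong {v} {w} v≃w = ℕP.≤-antisym
    (subst (ℓ v ≤_) (length-red w) (len-minimal (≃-trans (red-≃ w) (≃-sym v≃w))))
    (subst (ℓ w ≤_) (length-red v) (len-minimal (≃-trans (red-≃ v) v≃w)))

  ℓ≤length : ∀ w → ℓ w ≤ length w
  ℓ≤length w = len-minimal {w} ≃-refl

  ℓ-++ : ∀ x y → ℓ (x ++ y) ≤ ℓ x ℕ.+ ℓ y
  ℓ-++ x y = subst (ℓ (x ++ y) ≤_) (trans (LP.length-++ (red x)) (cong₂ ℕ._+_ (length-red x) (length-red y)))
    (len-minimal (≃-++ (red-≃ x) (red-≃ y)))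

  ℓ-snoc≤ : ∀ w s → ℓ (w ++ [ s ]) ≤ suc (ℓ w)
  ℓ-snoc≤ w s = ℕP.≤-trans (ℓ-++ w [ s ]) (subst (ℓ w ℕ.+ ℓ [ s ] ≤_) (ℕP.+-comm (ℓ w) 1) (ℕP.+-monoʳ-≤ (ℓ w) (ℓ≤length [ s ])))

  ℓ≤ℓ-snoc : ∀ w s → ℓ w ≤ suc (ℓ (w ++ [ s ]))
  ℓ≤ℓ-snoc w s = subst (_≤ suc (ℓ (w ++ [ s ]))) (ℓ-cong (snoc-snoc≃ w s)) (ℓ-snoc≤ (w ++ [ s ]) s)

  ℓ≡0⇒≃[] : ∀ w → ℓ w ≡ 0 → w ≃ []
  ℓ≡0⇒≃[] w ℓw≡0 with red w | red-≃ w | length-red w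
  ... | [] | r≃w | _ = ≃-sym r≃w
  ... | _ ∷ _ | _ | l = ⊥-elim (ℕP.1+n≢0 (trans l ℓw≡0))

  ℓ-reverse : ∀ w → ℓ (reverse w) ≡ ℓ w
  ℓ-reverse w = ℕP.≤-antisym (ℓ-reverse≤ w) (subst (λ z → ℓ z ≤ ℓ (reverse w)) (LP.reverse-involutive w) (ℓ-reverse≤ (reverse w)))
    where
    ℓ-reverse≤ : ∀ w → ℓ (reverse w) ≤ ℓ w
    ℓ-reverse≤ w = subst (ℓ (reverse w) ≤_) (trans (LP.length-reverse (red w)) (length-red w)) (len-minimal (≃-reverse (red-≃ w)))

  ℓ-reverse-snoc : ∀ i v → ℓ (reverse v ++ [ i ]) ≡ ℓ (i ∷ v)
  ℓ-reverse-snoc i v = trans (cong ℓ (sym (LP.unfold-reverse i v))) (ℓ-reverse (i ∷ v))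

even : ℕ → Bool
even zero = true
even (suc k) = not (even k)

ℤ² : Set
ℤ² = ℤ × ℤ

-- s and s′ acting on the coefficients (x , y) of β + x αₛ + y αₛ′, where p = aₛₛ′, q = aₛ′ₛ,
-- P = ⟨αₛ^∨ , β⟩ and Q = ⟨αₛ′^∨ , β⟩.
sStep : ℤ → ℤ → ℤ² → ℤ²
sStep p P (x , y) = (- x - y * p - P , y)

s′Step : ℤ → ℤ → ℤ² → ℤ²
s′Step q Q (x , y) = (x , - y - x * q - Q)

-- The alternating word of length k beginning with s (true) or with s′ (false).
coords : ℤ → ℤ → ℤ → ℤ → Bool → ℕ → ℤ² → ℤ²
coords p q P Q b zero c = c
coords p q P Q true (suc k) c = sStep p P (coords p q P Q false k c)
coords p q P Q false (suc k) c = s′Step q Q (coords p q P Q true k c)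

combine : ℤ → ℤ → ℤ² → ℤ² → ℤ²
combine P Q (x₁ , y₁) (x₂ , y₂) = (P * x₁ + Q * x₂ , P * y₁ + Q * y₂)

coords-combine : ∀ p q P Q b k c₁ c₂ →
  coords p q P Q b k (combine P Q c₁ c₂) ≡ combine P Q (coords p q (+ 1) (+ 0) b k c₁) (coords p q (+ 0) (+ 1) b k c₂)
coords-combine p q P Q b zero c₁ c₂ = refl
coords-combine p q P Q true (suc k) c₁ c₂ rewrite coords-combine p q P Q false k c₁ c₂
  with coords p q (+ 1) (+ 0) false k c₁ | coords p q (+ 0) (+ 1) false k c₂
... | (x₁ , y₁) | (x₂ , y₂) = cong (_, P * y₁ + Q * y₂)
  (solve 7 (λ p P Q x₁ y₁ x₂ y₂ → (:- (P :* x₁ :+ Q :* x₂)) :- (P :* y₁ :+ Q :* y₂) :* p :- P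
                                := P :* ((:- x₁) :- y₁ :* p :- con (+ 1)) :+ Q :* ((:- x₂) :- y₂ :* p :- con (+ 0)))
           refl p P Q x₁ y₁ x₂ y₂)
coords-combine p q P Q false (suc k) c₁ c₂ rewrite coords-combine p q P Q true k c₁ c₂
  with coords p q (+ 1) (+ 0) true k c₁ | coords p q (+ 0) (+ 1) true k c₂
... | (x₁ , y₁) | (x₂ , y₂) = cong (P * x₁ + Q * x₂ ,_)
  (solve 7 (λ q P Q x₁ y₁ x₂ y₂ → (:- (P :* y₁ :+ Q :* y₂)) :- (P :* x₁ :+ Q :* x₂) :* q :- Q
                                := P :* ((:- y₁) :- x₁ :* q :- con (+ 0)) :+ Q :* ((:- y₂) :- x₂ :* q :- con (+ 1)))
           refl q P Q x₁ y₁ x₂ y₂)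

Vanishes : ℤ → ℤ → Bool → ℕ → Set
Vanishes p q b k = coords p q (+ 1) (+ 0) b k (+ 0 , + 0) ≡ (+ 0 , + 0) × coords p q (+ 0) (+ 1) b k (+ 0 , + 0) ≡ (+ 0 , + 0)

coords-vanish : ∀ p q P Q b k → Vanishes p q b k → coords p q P Q b k (+ 0 , + 0) ≡ (+ 0 , + 0)
coords-vanish p q P Q b k (e₁ , e₂) = begin
    coords p q P Q b k (+ 0 , + 0)
  ≡⟨ cong (coords p q P Q b k) 0≡combine ⟩
    coords p q P Q b k (combine P Q (+ 0 , + 0) (+ 0 , + 0))
  ≡⟨ coords-combine p q P Q b k _ _ ⟩
    combine P Q (coords p q (+ 1) (+ 0) b k (+ 0 , + 0)) (coords p q (+ 0) (+ 1) b k (+ 0 , + 0))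
  ≡⟨ cong₂ (combine P Q) e₁ e₂ ⟩
    combine P Q (+ 0 , + 0) (+ 0 , + 0)
  ≡⟨ sym 0≡combine ⟩
    (+ 0 , + 0)
  ∎ where
    open ≡-Reasoning
    0≡combine : (+ 0 , + 0) ≡ combine P Q (+ 0 , + 0) (+ 0 , + 0)
    0≡combine = cong₂ _,_ e e
      where
      e : + 0 ≡ P * + 0 + Q * + 0
      e = solve 2 (λ P Q → con (+ 0) := P :* con (+ 0) :+ Q :* con (+ 0)) refl P Q

Braid : ℤ → ℤ → ℕ → Set
Braid p q k = Vanishes p q true k × Vanishes p q false k

Braid? : ∀ p q k → Dec (Braid p q k)
Braid? p q k = (≟² _ _ ×-dec ≟² _ _) ×-dec (≟² _ _ ×-dec ≟² _ _)
  where
  ≟² : (c d : ℤ²) → Dec (c ≡ d)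
  ≟² = ×-≡-dec ℤ._≟_ ℤ._≟_

NonNeg : ℤ² → Set
NonNeg (x , y) = (+ 0 ℤ.≤ x) × (+ 0 ℤ.≤ y)

NonNegBelow : ℤ → ℤ → ℕ → Set
NonNegBelow p q m = ∀ (k : Fin m) → NonNeg (coords p q (+ 0) (+ 0) (even (toℕ k)) (toℕ k) (+ 1 , + 0))

NonNegBelow? : ∀ p q m → Dec (NonNegBelow p q m)
NonNegBelow? p q m = all? (λ k → (+ 0 ℤ.≤? _) ×-dec (+ 0 ℤ.≤? _))

growth : ∀ c d u v → 4 ≤ d ℕ.* c → 2 ℕ.* v ≤ c ℕ.* u → 2 ℕ.* u ≤ d ℕ.* (c ℕ.* u ∸ v)
growth c d u v 4≤dc 2v≤cu = ℕP.*-cancelˡ-≤ 2 (begin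
    2 ℕ.* (2 ℕ.* u)   ≡⟨ sym (ℕP.*-assoc 2 2 u) ⟩
    4 ℕ.* u           ≤⟨ ℕP.*-monoˡ-≤ u 4≤dc ⟩
    (d ℕ.* c) ℕ.* u   ≡⟨ ℕP.*-assoc d c u ⟩
    d ℕ.* w           ≤⟨ ℕP.*-monoʳ-≤ d w≤2z ⟩
    d ℕ.* (2 ℕ.* z)   ≡⟨ trans (sym (ℕP.*-assoc d 2 z)) (trans (cong (ℕ._* z) (ℕP.*-comm d 2)) (ℕP.*-assoc 2 d z)) ⟩
    2 ℕ.* (d ℕ.* z)   ∎)
  where
  open ℕP.≤-Reasoning
  w = c ℕ.* u
  z = w ∸ v
  z+v≡w : z ℕ.+ v ≡ w
  z+v≡w = ℕP.m∸n+n≡m (ℕP.≤-trans (ℕP.m≤m+n v (v ℕ.+ 0)) 2v≤cu)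
  w≤2z : w ≤ 2 ℕ.* z
  w≤2z = ℕP.+-cancelʳ-≤ (2 ℕ.* v) w (2 ℕ.* z) (begin
      w ℕ.+ 2 ℕ.* v            ≤⟨ ℕP.+-monoʳ-≤ w 2v≤cu ⟩
      w ℕ.+ w                  ≡⟨ cong (λ t → t ℕ.+ t) (sym z+v≡w) ⟩
      (z ℕ.+ v) ℕ.+ (z ℕ.+ v)  ≡⟨ trans (cong ((z ℕ.+ v) ℕ.+_) (sym (ℕP.+-identityʳ (z ℕ.+ v)))) (ℕP.*-distribˡ-+ 2 z v) ⟩
      2 ℕ.* z ℕ.+ 2 ℕ.* v      ∎)

parity : ∀ k → (Σ ℕ λ i → k ≡ i ℕ.+ i × even k ≡ true) ⊎ (Σ ℕ λ i → k ≡ suc (i ℕ.+ i) × even k ≡ false)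
parity zero = inj₁ (0 , refl , refl)
parity (suc k) with parity k
... | inj₁ (i , refl , e) = inj₂ (i , refl , cong not e)
... | inj₂ (i , refl , e) = inj₁ (suc i , cong suc (sym (ℕP.+-suc i i)) , cong not e)

-- In the infinite case (a b ≥ 4) the coefficients stay natural numbers: even steps satisfy
-- 2 y ≤ b x, odd steps 2 x ≤ a y, and each step preserves this by `growth`.
module InfiniteDihedral (a b : ℕ) (4≤ab : 4 ≤ a ℕ.* b) where
  p q : ℤ
  p = - (+ a)
  q = - (+ b)

  mutual
    evenPt : ℕ → ℕ × ℕ
    evenPt zero = (1 , 0)
    evenPt (suc j) = (a ℕ.* proj₂ (oddPt j) ∸ proj₁ (oddPt j) , proj₂ (oddPt j))

    oddPt : ℕ → ℕ × ℕ
    oddPt j = (proj₁ (evenPt j) , b ℕ.* proj₁ (evenPt j) ∸ proj₂ (evenPt j))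

  mutual
    evenPt-invariant : ∀ j → 2 ℕ.* proj₂ (evenPt j) ≤ b ℕ.* proj₁ (evenPt j)
    evenPt-invariant zero = z≤n
    evenPt-invariant (suc j) = growth a b (proj₂ (oddPt j)) (proj₁ (oddPt j)) (subst (4 ≤_) (ℕP.*-comm a b) 4≤ab) (oddPt-invariant j)

    oddPt-invariant : ∀ j → 2 ℕ.* proj₁ (oddPt j) ≤ a ℕ.* proj₂ (oddPt j)
    oddPt-invariant j = growth b a (proj₁ (evenPt j)) (proj₂ (evenPt j)) 4≤ab (evenPt-invariant j)

  2*≤⇒≤ : ∀ {x y} → 2 ℕ.* x ≤ y → x ≤ y
  2*≤⇒≤ {x} = ℕP.≤-trans (ℕP.m≤m+n x (x ℕ.+ 0))

  +∸≡- : ∀ m k → k ≤ m → + (m ∸ k) ≡ + m - + k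
  +∸≡- m k k≤m = sym (trans (ℤP.m-n≡m⊖n m k) (ℤP.⊖-≥ k≤m))

  sStep-ℕ : ∀ x y → x ≤ a ℕ.* y → sStep p (+ 0) (+ x , + y) ≡ (+ (a ℕ.* y ∸ x) , + y)
  sStep-ℕ x y x≤ay = cong (_, + y) (begin
      - (+ x) - (+ y) * (- (+ a)) - + 0
    ≡⟨ solve 3 (λ x y a → (:- x) :- y :* (:- a) :- con (+ 0) := a :* y :- x) refl (+ x) (+ y) (+ a) ⟩
      + a * + y - + x
    ≡⟨ cong (_- + x) (sym (ℤP.pos-* a y)) ⟩
      + (a ℕ.* y) - + x
    ≡⟨ sym (+∸≡- (a ℕ.* y) x x≤ay) ⟩
      + (a ℕ.* y ∸ x)
    ∎) where open ≡-Reasoning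

  s′Step-ℕ : ∀ x y → y ≤ b ℕ.* x → s′Step q (+ 0) (+ x , + y) ≡ (+ x , + (b ℕ.* x ∸ y))
  s′Step-ℕ x y y≤bx = cong (+ x ,_) (begin
      - (+ y) - (+ x) * (- (+ b)) - + 0
    ≡⟨ solve 3 (λ x y b → (:- y) :- x :* (:- b) :- con (+ 0) := b :* x :- y) refl (+ x) (+ y) (+ b) ⟩
      + b * + x - + y
    ≡⟨ cong (_- + y) (sym (ℤP.pos-* b x)) ⟩
      + (b ℕ.* x) - + y
    ≡⟨ sym (+∸≡- (b ℕ.* x) y y≤bx) ⟩
      + (b ℕ.* x ∸ y)
    ∎) where open ≡-Reasoning

  toℤ² : ℕ × ℕ → ℤ²
  toℤ² (x , y) = (+ x , + y)

  mutual
    coords-even : ∀ j → coords p q (+ 0) (+ 0) true (j ℕ.+ j) (+ 1 , + 0) ≡ toℤ² (evenPt j)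
    coords-even zero = refl
    coords-even (suc j) = begin
        coords p q (+ 0) (+ 0) true (suc j ℕ.+ suc j) (+ 1 , + 0)
      ≡⟨ cong (λ t → coords p q (+ 0) (+ 0) true (suc t) (+ 1 , + 0)) (ℕP.+-suc j j) ⟩
        sStep p (+ 0) (coords p q (+ 0) (+ 0) false (suc (j ℕ.+ j)) (+ 1 , + 0))
      ≡⟨ cong (sStep p (+ 0)) (coords-odd j) ⟩
        sStep p (+ 0) (toℤ² (oddPt j))
      ≡⟨ sStep-ℕ (proj₁ (oddPt j)) (proj₂ (oddPt j)) (2*≤⇒≤ (oddPt-invariant j)) ⟩
        toℤ² (evenPt (suc j))
      ∎ where open ≡-Reasoning

    coords-odd : ∀ j → coords p q (+ 0) (+ 0) false (suc (j ℕ.+ j)) (+ 1 , + 0) ≡ toℤ² (oddPt j)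
    coords-odd j = begin
        s′Step q (+ 0) (coords p q (+ 0) (+ 0) true (j ℕ.+ j) (+ 1 , + 0))
      ≡⟨ cong (s′Step q (+ 0)) (coords-even j) ⟩
        s′Step q (+ 0) (toℤ² (evenPt j))
      ≡⟨ s′Step-ℕ (proj₁ (evenPt j)) (proj₂ (evenPt j)) (2*≤⇒≤ (evenPt-invariant j)) ⟩
        toℤ² (oddPt j)
      ∎ where open ≡-Reasoning

  nonneg : ∀ b j → even j ≡ b → NonNeg (coords p q (+ 0) (+ 0) b j (+ 1 , + 0))
  nonneg b j even-j with parity j
  ... | inj₁ (i , refl , e) with trans (sym even-j) e
  ...   | refl = subst NonNeg (sym (coords-even i)) (+≤+ z≤n , +≤+ z≤n)
  nonneg b j even-j | inj₂ (i , refl , e) with trans (sym even-j) e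
  ...   | refl = subst NonNeg (sym (coords-odd i)) (+≤+ z≤n , +≤+ z≤n)

data Order : Set where
  infinite : Order
  finite : ℕ → Order

-- `finite m₁` records that s s′ has order 1 + m₁.
Below : Order → ℕ → Set
Below infinite _ = ⊤
Below (finite m₁) j = j ≤ m₁

AtMost : Order → ℕ → Set
AtMost infinite _ = ⊤
AtMost (finite m₁) j = j ≤ suc m₁

AtMost-suc⇒Below : ∀ o j → AtMost o (suc j) → Below o j
AtMost-suc⇒Below infinite j _ = tt
AtMost-suc⇒Below (finite m₁) j = ℕP.≤-pred

AtMost-suc⇒AtMost : ∀ o j → AtMost o (suc j) → AtMost o j
AtMost-suc⇒AtMost infinite j _ = tt
AtMost-suc⇒AtMost (finite m₁) j = ℕP.≤-trans (ℕP.n≤1+n j)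

record Dihedral (p q : ℤ) : Set where
  field
    order : Order
    nonneg : ∀ b j → even j ≡ b → Below order j → NonNeg (coords p q (+ 0) (+ 0) b j (+ 1 , + 0))
    nonneg′ : ∀ b j → even j ≡ b → Below order j → NonNeg (coords q p (+ 0) (+ 0) b j (+ 1 , + 0))
    braid : ∀ {m₁} → order ≡ finite m₁ → Braid p q (suc m₁ ℕ.+ suc m₁)
    braid′ : ∀ {m₁} → order ≡ finite m₁ → Braid q p (suc m₁ ℕ.+ suc m₁)

swap : ∀ {p q} → Dihedral p q → Dihedral q p
swap D = record { order = order ; nonneg = nonneg′ ; nonneg′ = nonneg ; braid = braid′ ; braid′ = braid }
  where open Dihedral D

finiteDihedral : ∀ {p q} m₁ →
                 True (NonNegBelow? p q (suc m₁)) → True (NonNegBelow? q p (suc m₁)) →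
                 True (Braid? p q (suc m₁ ℕ.+ suc m₁)) → True (Braid? q p (suc m₁ ℕ.+ suc m₁)) → Dihedral p q
finiteDihedral {p} {q} m₁ nn nn′ br br′ = record
  { order = finite m₁
  ; nonneg = below (toWitness nn)
  ; nonneg′ = below (toWitness nn′)
  ; braid = λ { refl → toWitness br }
  ; braid′ = λ { refl → toWitness br′ }
  }
  where
  below : ∀ {p q} → NonNegBelow p q (suc m₁) → ∀ b j → even j ≡ b → j ≤ m₁ → NonNeg (coords p q (+ 0) (+ 0) b j (+ 1 , + 0))
  below {p} {q} nn b j refl j≤m₁ =
    subst (λ i → NonNeg (coords p q (+ 0) (+ 0) (even i) i (+ 1 , + 0))) (toℕ-fromℕ< (s≤s j≤m₁)) (nn (fromℕ< (s≤s j≤m₁)))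

infiniteDihedral : ∀ a b → 4 ≤ a ℕ.* b → Dihedral (- (+ a)) (- (+ b))
infiniteDihedral a b 4≤ab = record
  { order = infinite
  ; nonneg = λ β j e _ → InfiniteDihedral.nonneg a b 4≤ab β j e
  ; nonneg′ = λ β j e _ → InfiniteDihedral.nonneg b a (subst (4 ≤_) (ℕP.*-comm a b) 4≤ab) β j e
  ; braid = λ ()
  ; braid′ = λ ()
  }

4≤* : ∀ {a₀ b₀ a b} → 4 ≤ a₀ ℕ.* b₀ → a₀ ≤ a → b₀ ≤ b → 4 ≤ a ℕ.* b
4≤* 4≤a₀b₀ a₀≤a b₀≤b = ℕP.≤-trans 4≤a₀b₀ (ℕP.*-mono-≤ a₀≤a b₀≤b)

-- The classical list: (a , b) = (0 , 0), (1 , 1), (1 , 2), (1 , 3) and their transposes give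
-- the orders 2, 3, 4, 6; all other pairs have a b ≥ 4.
dihedral : ∀ a b → (a ≡ 0 → b ≡ 0) → (b ≡ 0 → a ≡ 0) → Dihedral (- (+ a)) (- (+ b))
dihedral 0 0 _ _ = finiteDihedral 1 _ _ _ _
dihedral 0 (suc b) a≡0⇒b≡0 _ with () ← a≡0⇒b≡0 refl
dihedral (suc a) 0 _ b≡0⇒a≡0 with () ← b≡0⇒a≡0 refl
dihedral 1 1 _ _ = finiteDihedral 2 _ _ _ _
dihedral 1 2 _ _ = finiteDihedral 3 _ _ _ _
dihedral 2 1 _ _ = finiteDihedral 3 _ _ _ _
dihedral 1 3 _ _ = finiteDihedral 5 _ _ _ _
dihedral 3 1 _ _ = finiteDihedral 5 _ _ _ _
dihedral 1 (suc (suc (suc (suc b)))) _ _ = infiniteDihedral 1 _ (4≤* {1} {4} ℕP.≤-refl ℕP.≤-refl (ℕP.m≤m+n 4 b))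
dihedral 2 (suc (suc b)) _ _ = infiniteDihedral 2 _ (4≤* {2} {2} ℕP.≤-refl ℕP.≤-refl (ℕP.m≤m+n 2 b))
dihedral (suc (suc (suc a))) (suc (suc b)) _ _ = infiniteDihedral _ _ (4≤* {3} {2} (ℕP.m≤m+n 4 2) (ℕP.m≤m+n 3 a) (ℕP.m≤m+n 2 b))
dihedral (suc (suc (suc (suc a)))) 1 _ _ = infiniteDihedral _ 1 (4≤* {4} {1} ℕP.≤-refl (ℕP.m≤m+n 4 a) ℕP.≤-refl)
alt : ∀ {X : Set} → X → X → ℕ → List X
alt f g zero = []
alt f g (suc k) = f ∷ alt g f k

altLast : ∀ {X : Set} → X → X → ℕ → X
altLast f g k = if even k then f else g

altTail : ∀ {X : Set} → X → X → ℕ → ℕ → List X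
altTail f g i j = if even i then alt f g j else alt g f j

length-alt : ∀ {X : Set} (f g : X) k → length (alt f g k) ≡ k
length-alt f g zero = refl
length-alt f g (suc k) = cong suc (length-alt g f k)

length-altTail : ∀ {X : Set} (f g : X) i j → length (altTail f g i j) ≡ j
length-altTail f g i j with even i
... | true = length-alt f g j
... | false = length-alt g f j

alt-snoc : ∀ {X : Set} (f g : X) k → alt f g (suc k) ≡ alt f g k ++ [ altLast f g k ]
alt-snoc f g zero = refl
alt-snoc f g (suc k) with even k in e
... | true = cong (f ∷_) (trans (alt-snoc g f k) (cong (λ b → alt g f k ++ [ if b then g else f ]) e))
... | false = cong (f ∷_) (trans (alt-snoc g f k) (cong (λ b → alt g f k ++ [ if b then g else f ]) e))

alt-split : ∀ {X : Set} (f g : X) i j → alt f g (i ℕ.+ j) ≡ alt f g i ++ altTail f g i j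
alt-split f g zero j = refl
alt-split f g (suc i) j with even i in e
... | true = cong (f ∷_) (trans (alt-split g f i j) (cong (λ b → alt g f i ++ (if b then alt g f j else alt f g j)) e))
... | false = cong (f ∷_) (trans (alt-split g f i j) (cong (λ b → alt g f i ++ (if b then alt g f j else alt f g j)) e))

reverse-alt : ∀ {X : Set} (f g : X) k → reverse (alt f g k) ≡ altTail g f k k
reverse-alt f g zero = refl
reverse-alt f g (suc k) = begin
    reverse (f ∷ alt g f k)             ≡⟨ LP.unfold-reverse f (alt g f k) ⟩
    reverse (alt g f k) ++ [ f ]        ≡⟨ cong (_++ [ f ]) (reverse-alt g f k) ⟩
    altTail f g k k ++ [ f ]            ≡⟨ snoc (even k) refl ⟩
    altTail g f (suc k) (suc k)         ∎
  where
  open ≡-Reasoning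
  snoc : ∀ b → even k ≡ b → (if b then alt f g k else alt g f k) ++ [ f ] ≡ altTail g f (suc k) (suc k)
  snoc true e rewrite e = sym (trans (alt-snoc f g k) (cong (λ b → alt f g k ++ [ if b then f else g ]) e))
  snoc false e rewrite e = sym (trans (alt-snoc g f k) (cong (λ b → alt g f k ++ [ if b then g else f ]) e))

reverse-altTail : ∀ {X : Set} (f g : X) k → reverse (altTail f g k k) ≡ alt g f k
reverse-altTail f g k with even k in e
... | true = trans (reverse-alt f g k) (cong (λ b → if b then alt g f k else alt f g k) e)
... | false = trans (reverse-alt g f k) (cong (λ b → if b then alt f g k else alt g f k) e)

nonpos⇒≡-abs : ∀ (p : ℤ) → p ℤ.≤ + 0 → p ≡ - (+ ℤ.∣ p ∣)
nonpos⇒≡-abs (+ zero) _ = refl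
nonpos⇒≡-abs (+ suc m) (+≤+ ())
nonpos⇒≡-abs -[1+ m ] _ = refl
-- Ties the Bool index of `coords` to the first letter f of the alternating word `alt f g`.
data Start {X : Set} (s s′ : X) : Bool → X → X → Set where
  fromS : Start s s′ true s s′
  fromS′ : Start s s′ false s′ s

flip-Start : ∀ {X : Set} {s s′ : X} {b f g} → Start s s′ b f g → Start s′ s (not b) f g
flip-Start fromS = fromS′
flip-Start fromS′ = fromS

altLast-cases : ∀ {X : Set} {s s′ : X} {b f g} → Start s s′ b f g → ∀ j → altLast f g j ≡ s ⊎ altLast f g j ≡ s′
altLast-cases {f = f} {g} st j with even j
altLast-cases fromS j | true = inj₁ refl
altLast-cases fromS j | false = inj₂ refl
altLast-cases fromS′ j | true = inj₂ refl
altLast-cases fromS′ j | false = inj₁ refl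

altLast≡s⇒even : ∀ {X : Set} {s s′ : X} {b f g} → s ≢ s′ → Start s s′ b f g → ∀ j → altLast f g j ≡ s → even j ≡ b
altLast≡s⇒even {f = f} {g} s≢s′ st j last≡s with even j
altLast≡s⇒even s≢s′ fromS j last≡s | true = refl
altLast≡s⇒even s≢s′ fromS j last≡s | false = ⊥-elim (s≢s′ (sym last≡s))
altLast≡s⇒even s≢s′ fromS′ j last≡s | true = ⊥-elim (s≢s′ (sym last≡s))
altLast≡s⇒even s≢s′ fromS′ j last≡s | false = refl

altLast-swap : ∀ {X : Set} {s s′ : X} {b f g} → Start s s′ b f g → ∀ j →
               (altLast f g j ≡ s × altLast g f j ≡ s′) ⊎ (altLast f g j ≡ s′ × altLast g f j ≡ s)
altLast-swap {f = f} {g} st j with even j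
altLast-swap fromS j | true = inj₁ (refl , refl)
altLast-swap fromS j | false = inj₂ (refl , refl)
altLast-swap fromS′ j | true = inj₂ (refl , refl)
altLast-swap fromS′ j | false = inj₁ (refl , refl)

dihedral-of : ∀ {n} (A : GCM n) (s s′ : Fin n) → s ≢ s′ → Dihedral (GCM.a A s s′) (GCM.a A s′ s)
dihedral-of A s s′ s≢s′ = subst₂ Dihedral (sym p≡) (sym q≡) (dihedral ∣ a s s′ ∣ ∣ a s′ s ∣ (∣a∣≡0⇒ s s′) (∣a∣≡0⇒ s′ s))
  where
  open GCM A
  p≡ : a s s′ ≡ - (+ ∣ a s s′ ∣)
  p≡ = nonpos⇒≡-abs _ (offdiag s s′ s≢s′)
  q≡ : a s′ s ≡ - (+ ∣ a s′ s ∣)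
  q≡ = nonpos⇒≡-abs _ (offdiag s′ s (s≢s′ ∘ sym))
  ∣a∣≡0⇒ : ∀ i j → ∣ a i j ∣ ≡ 0 → ∣ a j i ∣ ≡ 0
  ∣a∣≡0⇒ i j e = cong ∣_∣ (zeroSym i j (ℤP.∣i∣≡0⇒i≡0 e))

module RankTwo {n : ℕ} (A : GCM n) (s s′ : Fin n) (D : Dihedral (GCM.a A s s′) (GCM.a A s′ s)) where
  open GCM A
  open Action A
  open Weyl A
  open Dihedral D

  p q : ℤ
  p = a s s′
  q = a s′ s

  vec : Vector ℤ n → ℤ² → Vector ℤ n
  vec β c = β +ᵛ proj₁ c ·ᵛ δ s +ᵛ proj₂ c ·ᵛ δ s′

  pair-vec : ∀ j β c → pair j (vec β c) ≡ pair j β + proj₁ c * a j s + proj₂ c * a j s′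
  pair-vec j β (x , y) = begin
      pair j (β +ᵛ x ·ᵛ δ s +ᵛ y ·ᵛ δ s′)
    ≡⟨ pair-+ j (β +ᵛ x ·ᵛ δ s) (y ·ᵛ δ s′) ⟩
      pair j (β +ᵛ x ·ᵛ δ s) + pair j (y ·ᵛ δ s′)
    ≡⟨ cong₂ _+_ (pair-+ j β (x ·ᵛ δ s)) (trans (pair-· j y (δ s′)) (cong (y *_) (pair-δ j s′))) ⟩
      pair j β + pair j (x ·ᵛ δ s) + y * a j s′
    ≡⟨ cong (λ t → pair j β + t + y * a j s′) (trans (pair-· j x (δ s)) (cong (x *_) (pair-δ j s))) ⟩
      pair j β + x * a j s + y * a j s′
    ∎ where open ≡-Reasoning

  reflect-s-vec : ∀ β c → reflect s (vec β c) ≗ vec β (sStep p (pair s β) c)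
  reflect-s-vec β (x , y) k = begin
      vec β (x , y) k - pair s (vec β (x , y)) * δ s k
    ≡⟨ cong (λ t → vec β (x , y) k - t * δ s k) (trans (pair-vec s β (x , y)) (cong (λ t → pair s β + x * t + y * p) (diag s))) ⟩
      β k + x * δ s k + y * δ s′ k - (pair s β + x * + 2 + y * p) * δ s k
    ≡⟨ solve 7 (λ b x ds y ds′ P p → b :+ x :* ds :+ y :* ds′ :- (P :+ x :* con (+ 2) :+ y :* p) :* ds
                := b :+ ((:- x) :- y :* p :- P) :* ds :+ y :* ds′) refl (β k) x (δ s k) y (δ s′ k) (pair s β) p ⟩
      vec β (sStep p (pair s β) (x , y)) k
    ∎ where open ≡-Reasoning

  reflect-s′-vec : ∀ β c → reflect s′ (vec β c) ≗ vec β (s′Step q (pair s′ β) c)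
  reflect-s′-vec β (x , y) k = begin
      vec β (x , y) k - pair s′ (vec β (x , y)) * δ s′ k
    ≡⟨ cong (λ t → vec β (x , y) k - t * δ s′ k) (trans (pair-vec s′ β (x , y)) (cong (λ t → pair s′ β + x * q + y * t) (diag s′))) ⟩
      β k + x * δ s k + y * δ s′ k - (pair s′ β + x * q + y * + 2) * δ s′ k
    ≡⟨ solve 7 (λ b x ds y ds′ Q q → b :+ x :* ds :+ y :* ds′ :- (Q :+ x :* q :+ y :* con (+ 2)) :* ds′
                := b :+ x :* ds :+ ((:- y) :- x :* q :- Q) :* ds′) refl (β k) x (δ s k) y (δ s′ k) (pair s′ β) q ⟩
      vec β (s′Step q (pair s′ β) (x , y)) k
    ∎ where open ≡-Reasoning

  act-alt-vec : ∀ {b f g} → Start s s′ b f g → ∀ k β c →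
                act (alt f g k) (vec β c) ≗ vec β (coords p q (pair s β) (pair s′ β) b k c)
  act-alt-vec _ zero β c k′ = refl
  act-alt-vec fromS (suc k) β c k′ =
    trans (reflect-cong s (act-alt-vec fromS′ k β c) k′) (reflect-s-vec β (coords p q (pair s β) (pair s′ β) false k c) k′)
  act-alt-vec fromS′ (suc k) β c k′ =
    trans (reflect-cong s′ (act-alt-vec fromS k β c) k′) (reflect-s′-vec β (coords p q (pair s β) (pair s′ β) true k c) k′)

  vec-0 : ∀ β → β ≗ vec β (+ 0 , + 0)
  vec-0 β k = solve 3 (λ b d d′ → b := b :+ con (+ 0) :* d :+ con (+ 0) :* d′) refl (β k) (δ s k) (δ s′ k)

  act-alt-δs : ∀ {b f g} → Start s s′ b f g → ∀ k → act (alt f g k) (δ s) ≗ vec 0ᵛ (coords p q (+ 0) (+ 0) b k (+ 1 , + 0))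
  act-alt-δs {b} {f} {g} st k k′ = begin
      act (alt f g k) (δ s) k′
    ≡⟨ act-cong (alt f g k) δs≗vec k′ ⟩
      act (alt f g k) (vec 0ᵛ (+ 1 , + 0)) k′
    ≡⟨ act-alt-vec st k 0ᵛ (+ 1 , + 0) k′ ⟩
      vec 0ᵛ (coords p q (pair s 0ᵛ) (pair s′ 0ᵛ) b k (+ 1 , + 0)) k′
    ≡⟨ cong (λ c → vec 0ᵛ c k′) (cong₂ (λ P Q → coords p q P Q b k (+ 1 , + 0)) (pair-0ᵛ s) (pair-0ᵛ s′)) ⟩
      vec 0ᵛ (coords p q (+ 0) (+ 0) b k (+ 1 , + 0)) k′
    ∎ where
      open ≡-Reasoning
      δs≗vec : δ s ≗ vec 0ᵛ (+ 1 , + 0)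
      δs≗vec k = solve 2 (λ d d′ → d := con (+ 0) :+ con (+ 1) :* d :+ con (+ 0) :* d′) refl (δ s k) (δ s′ k)

  act-vec-Pos : ∀ v c → NonNeg c → Pos (act v (δ s)) → Pos (act v (δ s′)) → Pos (act v (vec 0ᵛ c))
  act-vec-Pos v (x , y) (0≤x , 0≤y) pos pos′ k = subst (+ 0 ℤ.≤_) (sym act≡)
      (nonneg-+ (nonneg-+ (subst (+ 0 ℤ.≤_) (sym (act-0ᵛ v k)) (+≤+ z≤n)) (nonneg-* 0≤x (pos k))) (nonneg-* 0≤y (pos′ k)))
    where
    act≡ : act v (0ᵛ +ᵛ x ·ᵛ δ s +ᵛ y ·ᵛ δ s′) k ≡ act v 0ᵛ k + x * act v (δ s) k + y * act v (δ s′) k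
    act≡ = trans (act-+ v (0ᵛ +ᵛ x ·ᵛ δ s) (y ·ᵛ δ s′) k)
      (cong₂ _+_ (trans (act-+ v 0ᵛ (x ·ᵛ δ s) k) (cong (_+_ (act v 0ᵛ k)) (act-· v x (δ s) k))) (act-· v y (δ s′) k))

  braid-≃[] : ∀ {b f g} → Start s s′ b f g → ∀ k → Vanishes p q b k → alt f g k ≃ []
  braid-≃[] {b} {f} {g} st k vanishes = mk≃ λ j k′ → begin
      act (alt f g k) (δ j) k′
    ≡⟨ act-cong (alt f g k) (vec-0 (δ j)) k′ ⟩
      act (alt f g k) (vec (δ j) (+ 0 , + 0)) k′
    ≡⟨ act-alt-vec st k (δ j) (+ 0 , + 0) k′ ⟩
      vec (δ j) (coords p q (pair s (δ j)) (pair s′ (δ j)) b k (+ 0 , + 0)) k′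
    ≡⟨ cong (λ c → vec (δ j) c k′) (coords-vanish p q (pair s (δ j)) (pair s′ (δ j)) b k vanishes) ⟩
      vec (δ j) (+ 0 , + 0) k′
    ≡⟨ sym (vec-0 (δ j) k′) ⟩
      δ j k′
    ∎ where open ≡-Reasoning

  alt-order-≃[] : ∀ {m₁ b f g} → order ≡ finite m₁ → Start s s′ b f g → alt f g (suc m₁ ℕ.+ suc m₁) ≃ []
  alt-order-≃[] e fromS = braid-≃[] fromS _ (proj₁ (braid e))
  alt-order-≃[] e fromS′ = braid-≃[] fromS′ _ (proj₂ (braid e))

  ℓ-alt-order+1 : ∀ {m₁ b f g} → order ≡ finite m₁ → Start s s′ b f g → ℓ (alt f g (suc (suc m₁))) ≤ m₁
  ℓ-alt-order+1 {m₁} {b} {f} {g} e st =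
    subst (ℓ X ≤_) (trans (LP.length-reverse Y) (length-altTail f g (suc (suc m₁)) m₁))
          (len-minimal (≃-sym (++≃[]⇒≃reverse X Y XY≃[])))
    where
    X = alt f g (suc (suc m₁))
    Y = altTail f g (suc (suc m₁)) m₁
    XY≃[] : X ++ Y ≃ []
    XY≃[] = subst (_≃ []) (trans (cong (alt f g) (cong suc (ℕP.+-suc m₁ m₁))) (alt-split f g (suc (suc m₁)) m₁))
                  (alt-order-≃[] e st)

  ℓ-alt-beyond-order : ∀ {m₁ b f g} → order ≡ finite m₁ → Start s s′ b f g → ∀ k → suc (suc m₁) ≤ k → ℓ (alt f g k) < k
  ℓ-alt-beyond-order {m₁} {b} {f} {g} e st k 2+m₁≤k = begin-strict
      ℓ (alt f g k)                   ≡⟨ cong ℓ (trans (cong (alt f g) k≡) (alt-split f g (suc (suc m₁)) r)) ⟩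
      ℓ (alt f g (suc (suc m₁)) ++ Z) ≤⟨ ℓ-++ (alt f g (suc (suc m₁))) Z ⟩
      ℓ (alt f g (suc (suc m₁))) ℕ.+ ℓ Z ≤⟨ ℕP.+-mono-≤ (ℓ-alt-order+1 e st) (subst (ℓ Z ≤_) (length-altTail f g (suc (suc m₁)) r) (ℓ≤length Z)) ⟩
      m₁ ℕ.+ r                        <⟨ ℕP.+-monoˡ-< r (ℕP.≤-trans (ℕP.n<1+n m₁) (ℕP.n≤1+n (suc m₁))) ⟩
      suc (suc m₁) ℕ.+ r              ≡⟨ sym k≡ ⟩
      k                               ∎
    where
    open ℕP.≤-Reasoning
    r = k ∸ suc (suc m₁)
    k≡ : k ≡ suc (suc m₁) ℕ.+ r
    k≡ = sym (ℕP.m+[n∸m]≡n 2+m₁≤k)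
    Z = altTail f g (suc (suc m₁)) r

  altLast-s : ∀ {b f g} → Start s s′ b f g → ∀ k → even k ≡ b → altLast f g k ≡ s
  altLast-s fromS k e rewrite e = refl
  altLast-s fromS′ k e rewrite e = refl

  altLast≢s : ∀ {b f g} → Start s s′ b f g → ∀ k → altLast f g k ≢ s → even (suc k) ≡ b
  altLast≢s {f = f} {g} st k last≢s with even k in e
  altLast≢s fromS k last≢s | true = ⊥-elim (last≢s refl)
  altLast≢s fromS k last≢s | false = refl
  altLast≢s fromS′ k last≢s | true = refl
  altLast≢s fromS′ k last≢s | false = ⊥-elim (last≢s refl)

  ascent-parity : ∀ {b f g} → Start s s′ b f g → ∀ k → k ≤ ℓ (alt f g k ++ [ s ]) → k ≡ 0 ⊎ even k ≡ b
  ascent-parity st zero _ = inj₁ refl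
  ascent-parity {b} {f} {g} st (suc k) k<ℓ = inj₂ (altLast≢s st k last≢s)
    where
    last≢s : altLast f g k ≢ s
    last≢s last≡s = ℕP.<-irrefl refl (ℕP.<-≤-trans (s≤s short) k<ℓ)
      where
      short : ℓ (alt f g (suc k) ++ [ s ]) ≤ k
      short = begin
        ℓ (alt f g (suc k) ++ [ s ])          ≡⟨ cong (λ x → ℓ (x ++ [ s ])) (trans (alt-snoc f g k) (cong (λ x → alt f g k ++ [ x ]) last≡s)) ⟩
        ℓ ((alt f g k ++ [ s ]) ++ [ s ])     ≡⟨ ℓ-cong (snoc-snoc≃ (alt f g k) s) ⟩
        ℓ (alt f g k)                         ≤⟨ ℓ≤length (alt f g k) ⟩
        length (alt f g k)                    ≡⟨ length-alt f g k ⟩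
        k                                     ∎
        where open ℕP.≤-Reasoning

  alt-δs-Pos : ∀ {b f g} → Start s s′ b f g → ∀ j → even j ≡ b → Below order j →
               ∀ v → Pos (act v (δ s)) → Pos (act v (δ s′)) → Pos (act (v ++ alt f g j) (δ s))
  alt-δs-Pos {b} {f} {g} st j even-j below v pos pos′ k = subst (+ 0 ℤ.≤_)
    (sym (trans (act-++ v (alt f g j) (δ s) k) (act-cong v (act-alt-δs st j) k)))
    (act-vec-Pos v _ (nonneg b j even-j below) pos pos′ k)

  braid-relation : ∀ {m₁ b f g} → order ≡ finite m₁ → Start s s′ b f g → alt f g (suc m₁) ≃ alt g f (suc m₁)
  braid-relation {m₁} {b} {f} {g} e st = subst (alt f g (suc m₁) ≃_) (reverse-altTail f g (suc m₁))
    (++≃[]⇒≃reverse (alt f g (suc m₁)) (altTail f g (suc m₁) (suc m₁))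
      (subst (_≃ []) (alt-split f g (suc m₁) (suc m₁)) (alt-order-≃[] e st)))

  order-view : (order ≡ infinite) ⊎ Σ ℕ (λ m₁ → order ≡ finite m₁)
  order-view with order
  ... | infinite = inj₁ refl
  ... | finite m₁ = inj₂ (m₁ , refl)

  alt-δs-NonNeg : ∀ {b f g} → Start s s′ b f g → ∀ k → ℓ (alt f g k) ≡ k → k ≤ ℓ (alt f g k ++ [ s ]) →
                  NonNeg (coords p q (+ 0) (+ 0) b k (+ 1 , + 0))
  alt-δs-NonNeg {b} {f} {g} st k ℓ≡k k≤ with ascent-parity st k k≤ | order-view
  ... | inj₁ refl | _ = +≤+ z≤n , +≤+ z≤n
  ... | inj₂ even-k | inj₁ e = nonneg b k even-k (subst (λ o → Below o k) (sym e) tt)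
  ... | inj₂ even-k | inj₂ (m₁ , e) with ℕP.<-cmp k (suc m₁)
  ...   | tri< k<1+m₁ _ _ = nonneg b k even-k (subst (λ o → Below o k) (sym e) (ℕP.≤-pred k<1+m₁))
  ...   | tri≈ _ refl _ = ⊥-elim (ℕP.<-irrefl refl (ℕP.<-≤-trans (s≤s long) k≤))
    where
    long : ℓ (alt f g k ++ [ s ]) ≤ m₁
    long = subst (λ x → ℓ x ≤ m₁) (trans (alt-snoc f g k) (cong (λ x → alt f g k ++ [ x ]) (altLast-s st k even-k)))
                 (ℓ-alt-order+1 e st)
  ...   | tri> _ _ 1+m₁<k = ⊥-elim (ℕP.<-irrefl ℓ≡k (ℓ-alt-beyond-order e st k 1+m₁<k))

module Positivity {n : ℕ} (A : GCM n) where
  open GCM A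
  open Action A
  open Weyl A

  suffix-ℓ≥ : ∀ {w} v x {k} → w ≃ v ++ x → ℓ w ≡ ℓ v ℕ.+ k → ∀ y → ℓ w ≤ ℓ (w ++ y) → k ≤ ℓ (x ++ y)
  suffix-ℓ≥ {w} v x {k} w≃vx ℓw≡ y ℓw≤ = ℕP.+-cancelˡ-≤ (ℓ v) k (ℓ (x ++ y)) (begin
    ℓ v ℕ.+ k           ≡⟨ sym ℓw≡ ⟩
    ℓ w                 ≤⟨ ℓw≤ ⟩
    ℓ (w ++ y)          ≡⟨ ℓ-cong (≃-++ʳ y w≃vx) ⟩
    ℓ ((v ++ x) ++ y)   ≡⟨ cong ℓ (LP.++-assoc v x y) ⟩
    ℓ (v ++ (x ++ y))   ≤⟨ ℓ-++ v (x ++ y) ⟩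
    ℓ v ℕ.+ ℓ (x ++ y)  ∎)
    where open ℕP.≤-Reasoning

  suffix-ℓ≥-length : ∀ {w} v x {k} → w ≃ v ++ x → ℓ w ≡ ℓ v ℕ.+ k → k ≤ ℓ x
  suffix-ℓ≥-length {w} v x {k} w≃vx ℓw≡ = subst (k ≤_) (cong ℓ (LP.++-identityʳ x))
    (suffix-ℓ≥ v x w≃vx ℓw≡ [] (ℕP.≤-reflexive (cong ℓ (sym (LP.++-identityʳ w)))))

  PosAscent : ℕ → Set
  PosAscent m = ∀ w s → ℓ w ≡ m → ℓ w ≤ ℓ (w ++ [ s ]) → Pos (act w (δ s))

  module ParabolicSplit (m′ : ℕ) (w : Word n) (s s′ : Fin n) where

    record Split : Set where
      field
        v : Word n
        b : Bool
        f g : Fin n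
        start : Start s s′ b f g
        k : ℕ
        w≃ : w ≃ v ++ alt f g k
        ℓw≡ : ℓ w ≡ ℓ v ℕ.+ k
        ℓv≤ : ℓ v ≤ m′
        s-ascent : ℓ v ≤ ℓ (v ++ [ s ])
        s′-ascent : ℓ v ≤ ℓ (v ++ [ s′ ])

    shift : ∀ v t x k → w ≃ v ++ x → length x ≡ k → ℓ w ≡ ℓ v ℕ.+ k → ℓ (v ++ [ t ]) < ℓ v →
            (w ≃ (v ++ [ t ]) ++ t ∷ x) × (ℓ w ≡ ℓ (v ++ [ t ]) ℕ.+ suc k) × (suc (ℓ (v ++ [ t ])) ≡ ℓ v)
    shift v t x k w≃vx lx≡k ℓw≡ vt<v = w≃ , ℓw≡′ , 1+ℓvt≡ℓv
      where
      vt = v ++ [ t ]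
      w≃ : w ≃ vt ++ t ∷ x
      w≃ = ≃-trans w≃vx (≃-sym (subst (_≃ v ++ x) (sym (LP.++-assoc v [ t ] (t ∷ x))) (≃-++ˡ v (ii∷≃ t x))))
      ℓw≤ : ℓ w ≤ ℓ vt ℕ.+ suc k
      ℓw≤ = ℕP.≤-trans (ℕP.≤-reflexive (ℓ-cong w≃))
             (ℕP.≤-trans (ℓ-++ vt (t ∷ x)) (ℕP.+-monoʳ-≤ (ℓ vt) (subst (ℓ (t ∷ x) ≤_) (cong suc lx≡k) (ℓ≤length (t ∷ x)))))
      1+ℓvt≡ℓv : suc (ℓ vt) ≡ ℓ v
      1+ℓvt≡ℓv = ℕP.≤-antisym vt<v (ℕP.+-cancelʳ-≤ k (ℓ v) (suc (ℓ vt))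
                   (subst (_≤ suc (ℓ vt) ℕ.+ k) ℓw≡ (subst (ℓ w ≤_) (ℕP.+-suc (ℓ vt) k) ℓw≤)))
      ℓw≡′ : ℓ w ≡ ℓ vt ℕ.+ suc k
      ℓw≡′ = trans ℓw≡ (trans (cong (ℕ._+ k) (sym 1+ℓvt≡ℓv)) (sym (ℕP.+-suc (ℓ vt) k)))

    no-repeat : ∀ v t x k → w ≃ v ++ t ∷ x → length x ≡ k → ℓ w ≡ ℓ v ℕ.+ suc k → ℓ (v ++ [ t ]) < ℓ v → ⊥
    no-repeat v t x k w≃vtx lx≡k ℓw≡ vt<v = ℕP.<-irrefl ℓw≡ (begin-strict
        ℓ w                          ≡⟨ ℓ-cong (subst (w ≃_) (sym (LP.++-assoc v [ t ] x)) w≃vtx) ⟩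
        ℓ ((v ++ [ t ]) ++ x)        ≤⟨ ℓ-++ (v ++ [ t ]) x ⟩
        ℓ (v ++ [ t ]) ℕ.+ ℓ x       <⟨ ℕP.+-mono-<-≤ vt<v (subst (ℓ x ≤_) lx≡k (ℓ≤length x)) ⟩
        ℓ v ℕ.+ k                    ≤⟨ ℕP.+-monoʳ-≤ (ℓ v) (ℕP.n≤1+n k) ⟩
        ℓ v ℕ.+ suc k                ∎)
      where open ℕP.≤-Reasoning

    -- Peel descents s, s′ off the right end of v onto the alternating word, until v has neither.
    split : ∀ fuel v {b f g} → Start s s′ b f g → ∀ k → ℓ v ≡ fuel → w ≃ v ++ alt f g k → ℓ w ≡ ℓ v ℕ.+ k → ℓ v ≤ m′ → Split
    split fuel v {b} {f} {g} st k ℓv≡ w≃ ℓw≡ ℓv≤ with ℓ (v ++ [ s ]) ℕP.<? ℓ v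
    split zero v st k ℓv≡ w≃ ℓw≡ ℓv≤ | yes vs<v = ⊥-elim (ℕP.n≮0 (subst (ℓ (v ++ [ s ]) <_) ℓv≡ vs<v))
    split (suc fuel) v st zero ℓv≡ w≃ ℓw≡ ℓv≤ | yes vs<v =
      let (w≃′ , ℓw≡′ , ℓv≡′) = shift v s [] 0 w≃ refl ℓw≡ vs<v
      in split fuel (v ++ [ s ]) fromS 1 (ℕP.suc-injective (trans ℓv≡′ ℓv≡)) w≃′ ℓw≡′ (ℕP.≤-trans (ℕP.<⇒≤ vs<v) ℓv≤)
    split (suc fuel) v fromS′ (suc k) ℓv≡ w≃ ℓw≡ ℓv≤ | yes vs<v =
      let (w≃′ , ℓw≡′ , ℓv≡′) = shift v s (alt s′ s (suc k)) (suc k) w≃ (length-alt s′ s (suc k)) ℓw≡ vs<v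
      in split fuel (v ++ [ s ]) fromS (suc (suc k)) (ℕP.suc-injective (trans ℓv≡′ ℓv≡)) w≃′ ℓw≡′ (ℕP.≤-trans (ℕP.<⇒≤ vs<v) ℓv≤)
    split (suc fuel) v fromS (suc k) ℓv≡ w≃ ℓw≡ ℓv≤ | yes vs<v =
      ⊥-elim (no-repeat v s (alt s′ s k) k w≃ (length-alt s′ s k) ℓw≡ vs<v)
    ... | no vs≮v with ℓ (v ++ [ s′ ]) ℕP.<? ℓ v
    split zero v st k ℓv≡ w≃ ℓw≡ ℓv≤ | no _ | yes vs′<v = ⊥-elim (ℕP.n≮0 (subst (ℓ (v ++ [ s′ ]) <_) ℓv≡ vs′<v))
    split (suc fuel) v st zero ℓv≡ w≃ ℓw≡ ℓv≤ | no _ | yes vs′<v =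
      let (w≃′ , ℓw≡′ , ℓv≡′) = shift v s′ [] 0 w≃ refl ℓw≡ vs′<v
      in split fuel (v ++ [ s′ ]) fromS′ 1 (ℕP.suc-injective (trans ℓv≡′ ℓv≡)) w≃′ ℓw≡′ (ℕP.≤-trans (ℕP.<⇒≤ vs′<v) ℓv≤)
    split (suc fuel) v fromS (suc k) ℓv≡ w≃ ℓw≡ ℓv≤ | no _ | yes vs′<v =
      let (w≃′ , ℓw≡′ , ℓv≡′) = shift v s′ (alt s s′ (suc k)) (suc k) w≃ (length-alt s s′ (suc k)) ℓw≡ vs′<v
      in split fuel (v ++ [ s′ ]) fromS′ (suc (suc k)) (ℕP.suc-injective (trans ℓv≡′ ℓv≡)) w≃′ ℓw≡′ (ℕP.≤-trans (ℕP.<⇒≤ vs′<v) ℓv≤)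
    split (suc fuel) v fromS′ (suc k) ℓv≡ w≃ ℓw≡ ℓv≤ | no _ | yes vs′<v =
      ⊥-elim (no-repeat v s′ (alt s s′ k) k w≃ (length-alt s s′ k) ℓw≡ vs′<v)
    split fuel v {b} {f} {g} st k ℓv≡ w≃ ℓw≡ ℓv≤ | no vs≮v | no vs′≮v = record
      { v = v ; b = b ; f = f ; g = g ; start = st ; k = k ; w≃ = w≃ ; ℓw≡ = ℓw≡ ; ℓv≤ = ℓv≤
      ; s-ascent = ℕP.≮⇒≥ vs≮v ; s′-ascent = ℕP.≮⇒≥ vs′≮v }

  -- Humphreys' argument: split w = v · u with u in the dihedral subgroup of s and the last letter
  -- s′ of a reduced word; the induction hypothesis makes v αₛ, v αₛ′ positive, and u αₛ is a
  -- nonnegative combination of αₛ and αₛ′ by the rank-two analysis.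
  ascent⇒Pos-step : ∀ m′ → (∀ m → m < suc m′ → PosAscent m) → PosAscent (suc m′)
  ascent⇒Pos-step m′ IH w s ℓw≡1+m′ ℓw≤ = Pos-from (split ℓr r fromS′ 1 refl w≃rs′ ℓw≡′ (ℕP.≤-reflexive ℓr≡))
    where
    rd = snoc-decomp (red w) (trans (length-red w) ℓw≡1+m′)
    r = proj₁ rd
    s′ = proj₁ (proj₂ rd)
    ℓr = ℓ r
    w≃rs′ : w ≃ r ++ [ s′ ]
    w≃rs′ = subst (w ≃_) (proj₁ (proj₂ (proj₂ rd))) (≃-sym (red-≃ w))
    ℓr≡ : ℓ r ≡ m′
    ℓr≡ = ℕP.≤-antisym (subst (ℓ r ≤_) (proj₂ (proj₂ (proj₂ rd))) (ℓ≤length r))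
            (ℕP.≤-pred (subst (_≤ suc (ℓ r)) (trans (ℓ-cong (≃-sym w≃rs′)) ℓw≡1+m′) (ℓ-snoc≤ r s′)))
    ℓw≡′ : ℓ w ≡ ℓ r ℕ.+ 1
    ℓw≡′ = trans ℓw≡1+m′ (trans (ℕP.+-comm 1 m′) (cong (ℕ._+ 1) (sym ℓr≡)))
    s≢s′ : s ≢ s′
    s≢s′ refl = ℕP.<-irrefl refl (ℕP.<-≤-trans (subst (ℓ (w ++ [ s ]) <_) (sym ℓw≡1+m′) ws<1+m′) ℓw≤)
      where
      ws<1+m′ : ℓ (w ++ [ s ]) < suc m′
      ws<1+m′ = subst (_< suc m′) (sym (trans (ℓ-cong (≃-trans (≃-++ʳ [ s ] w≃rs′) (snoc-snoc≃ r s))) ℓr≡)) (ℕP.n<1+n m′)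
    open ParabolicSplit m′ w s s′
    open RankTwo A s s′ (dihedral-of A s s′ s≢s′)
    Pos-from : Split → Pos (act w (δ s))
    Pos-from sp k′ = subst (+ 0 ℤ.≤_) (sym act≡) (act-vec-Pos v _ nn (IH (ℓ v) (s≤s ℓv≤) v s refl s-ascent)
                                                               (IH (ℓ v) (s≤s ℓv≤) v s′ refl s′-ascent) k′)
      where
      open Split sp
      u = alt f g k
      ℓu≡k : ℓ u ≡ k
      ℓu≡k = ℕP.≤-antisym (subst (ℓ u ≤_) (length-alt f g k) (ℓ≤length u))
               (suffix-ℓ≥-length v u w≃ ℓw≡)
      nn = alt-δs-NonNeg start k ℓu≡k (suffix-ℓ≥ v u w≃ ℓw≡ [ s ] ℓw≤)
      act≡ : act w (δ s) k′ ≡ act v (vec 0ᵛ (coords p q (+ 0) (+ 0) b k (+ 1 , + 0))) k′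
      act≡ = trans (≃-act w≃ (δ s) k′) (trans (act-++ v u (δ s) k′) (act-cong v (act-alt-δs start k) k′))

  ascent⇒Pos : ∀ w s → ℓ w ≤ ℓ (w ++ [ s ]) → Pos (act w (δ s))
  ascent⇒Pos w s = <-rec PosAscent step (ℓ w) w s refl
    where
    step : ∀ m → (∀ {m′} → m′ < m → PosAscent m′) → PosAscent m
    step zero _ w s ℓw≡0 _ k = subst (+ 0 ℤ.≤_) (sym (≃-act (ℓ≡0⇒≃[] w ℓw≡0) (δ s) k)) (δ-nonneg s k)
    step (suc m′) IH = ascent⇒Pos-step m′ (λ m → IH {m})

  snoc-Neg : ∀ w s → ℓ (w ++ [ s ]) ≤ ℓ w → Neg (act w (δ s))
  snoc-Neg w s ℓws≤ k = neg-nonneg⇒nonpos (subst (+ 0 ℤ.≤_) (trans (act-snoc-δ w s k) (ℤP.-1*i≡-i _))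
    (ascent⇒Pos (w ++ [ s ]) s (subst (ℓ (w ++ [ s ]) ≤_) (sym (ℓ-cong (snoc-snoc≃ w s))) ℓws≤) k))

  ascent-or-descent : ∀ w s → (ℓ (w ++ [ s ]) ≡ suc (ℓ w) × Pos (act w (δ s))) ⊎ (suc (ℓ (w ++ [ s ])) ≡ ℓ w × Neg (act w (δ s)))
  ascent-or-descent w s with ℓ w ℕP.≤? ℓ (w ++ [ s ])
  ... | no ℓw≰ = inj₂ (ℕP.≤-antisym (ℕP.≰⇒> ℓw≰) (ℓ≤ℓ-snoc w s) , snoc-Neg w s (ℕP.<⇒≤ (ℕP.≰⇒> ℓw≰)))
  ... | yes ℓw≤ with ℕP.m≤n⇒m<n∨m≡n ℓw≤
  ...   | inj₁ ℓw< = inj₁ (ℕP.≤-antisym (ℓ-snoc≤ w s) ℓw< , ascent⇒Pos w s ℓw≤)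
  ...   | inj₂ ℓw≡ = ⊥-elim (root-not-Pos-and-Neg w s (ascent⇒Pos w s ℓw≤) (snoc-Neg w s (ℕP.≤-reflexive (sym ℓw≡))))

  Pos-or-Neg : ∀ w s → Pos (act w (δ s)) ⊎ Neg (act w (δ s))
  Pos-or-Neg w s with ascent-or-descent w s
  ... | inj₁ (_ , pos) = inj₁ pos
  ... | inj₂ (_ , neg) = inj₂ neg

  Pos⇒ascent : ∀ u x → Pos (act u (δ x)) → ℓ (u ++ [ x ]) ≡ suc (ℓ u)
  Pos⇒ascent u x pos with ascent-or-descent u x
  ... | inj₁ (ℓ≡ , _) = ℓ≡
  ... | inj₂ (_ , neg) = ⊥-elim (root-not-Pos-and-Neg u x pos neg)

  all-Pos⇒≃[] : ∀ t → (∀ i → Pos (act t (δ i))) → t ≃ []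
  all-Pos⇒≃[] t pos with ℓ t in ℓt≡
  ... | zero = ℓ≡0⇒≃[] t ℓt≡
  ... | suc m with snoc-decomp (red t) (trans (length-red t) ℓt≡)
  ...   | r , s , red≡ , lr≡ = ⊥-elim (ℕP.<-irrefl refl (ℕP.<-trans (ℕP.n<1+n m) (subst (_≤ m) (trans (Pos⇒ascent t s (pos s)) (cong suc ℓt≡)) ts≤)))
    where
    t≃ : t ≃ r ++ [ s ]
    t≃ = subst (t ≃_) red≡ (≃-sym (red-≃ t))
    ts≤ : ℓ (t ++ [ s ]) ≤ m
    ts≤ = subst (_≤ m) (sym (ℓ-cong (≃-trans (≃-++ʳ [ s ] t≃) (snoc-snoc≃ r s)))) (subst (ℓ r ≤_) lr≡ (ℓ≤length r))
module Parabolic {n : ℕ} (A : GCM n) (s s′ : Fin n) (s≢s′ : s ≢ s′) where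
  open GCM A
  open Action A
  open Weyl A
  open Positivity A

  D : Dihedral (a s s′) (a s′ s)
  D = dihedral-of A s s′ s≢s′

  open Dihedral D using (order)
  module R = RankTwo A s s′ D
  module R′ = RankTwo A s′ s (swap D)
  module Rᵀ = RankTwo (transpose A) s s′ (swap D)

  alt-last-Pos : ∀ {b f g} → Start s s′ b f g → ∀ j → Below order j → ∀ v → Pos (act v (δ s)) → Pos (act v (δ s′)) →
                 Pos (act (v ++ alt f g j) (δ (altLast f g j)))
  alt-last-Pos {f = f} {g} st j below v pos pos′ with altLast-cases st j
  ... | inj₁ last≡s rewrite last≡s = R.alt-δs-Pos st j (altLast≡s⇒even s≢s′ st j last≡s) below v pos pos′
  ... | inj₂ last≡s′ rewrite last≡s′ =
    R′.alt-δs-Pos (flip-Start st) j (altLast≡s⇒even (s≢s′ ∘ sym) (flip-Start st) j last≡s′) below v pos′ pos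

  ℓ-++-alt : ∀ v → Pos (act v (δ s)) → Pos (act v (δ s′)) → ∀ {b f g} → Start s s′ b f g →
             ∀ j → AtMost order j → ℓ (v ++ alt f g j) ≡ ℓ v ℕ.+ j
  ℓ-++-alt v pos pos′ st zero _ = trans (cong ℓ (LP.++-identityʳ v)) (sym (ℕP.+-identityʳ (ℓ v)))
  ℓ-++-alt v pos pos′ {f = f} {g} st (suc j) atMost = begin
      ℓ (v ++ alt f g (suc j))
    ≡⟨ cong ℓ (trans (cong (v ++_) (alt-snoc f g j)) (sym (LP.++-assoc v (alt f g j) [ altLast f g j ]))) ⟩
      ℓ ((v ++ alt f g j) ++ [ altLast f g j ])
    ≡⟨ Pos⇒ascent (v ++ alt f g j) (altLast f g j) (alt-last-Pos st j (AtMost-suc⇒Below order j atMost) v pos pos′) ⟩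
      suc (ℓ (v ++ alt f g j))
    ≡⟨ cong suc (ℓ-++-alt v pos pos′ st j (AtMost-suc⇒AtMost order j atMost)) ⟩
      suc (ℓ v ℕ.+ j)
    ≡⟨ sym (ℕP.+-suc (ℓ v) j) ⟩
      ℓ v ℕ.+ suc j
    ∎ where open ≡-Reasoning

  record TwoDescents (w : Word n) : Set where
    field
      m₁ : ℕ
      finite-order : order ≡ finite m₁
      z : Word n
      b : Bool
      f g : Fin n
      start : Start s s′ b f g
      w≃ : w ≃ z ++ alt f g (suc m₁)
      ℓw≡ : ℓ w ≡ ℓ z ℕ.+ suc m₁

  -- A word with both s and s′ as right descents ends with the longest element of ⟨s , s′⟩,
  -- which forces that subgroup to be finite.
  two-descents : ∀ w → ℓ (w ++ [ s ]) < ℓ w → ℓ (w ++ [ s′ ]) < ℓ w → TwoDescents w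
  two-descents w ws<w ws′<w = from-order R.order-view
    where
    open ParabolicSplit (ℓ w) w s s′
    sp : Split
    sp = split (ℓ w) w fromS 0 refl (subst (w ≃_) (sym (LP.++-identityʳ w)) ≃-refl) (sym (ℕP.+-identityʳ (ℓ w))) ℕP.≤-refl
    open Split sp
    x = altLast f g k
    wx<w : ℓ (w ++ [ x ]) < ℓ w
    wx<w with altLast-cases start k
    ... | inj₁ x≡s = subst (λ y → ℓ (w ++ [ y ]) < ℓ w) (sym x≡s) ws<w
    ... | inj₂ x≡s′ = subst (λ y → ℓ (w ++ [ y ]) < ℓ w) (sym x≡s′) ws′<w
    ¬AtMost : AtMost order (suc k) → ⊥
    ¬AtMost atMost = ℕP.<-irrefl refl (ℕP.<-trans wx<w (subst (ℓ w <_) (sym ℓwx≡) (ℕP.n<1+n (ℓ w))))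
      where
      ℓwx≡ : ℓ (w ++ [ x ]) ≡ suc (ℓ w)
      ℓwx≡ = begin
        ℓ (w ++ [ x ])               ≡⟨ ℓ-cong (≃-++ʳ [ x ] w≃) ⟩
        ℓ ((v ++ alt f g k) ++ [ x ]) ≡⟨ cong ℓ (trans (LP.++-assoc v (alt f g k) [ x ]) (cong (v ++_) (sym (alt-snoc f g k)))) ⟩
        ℓ (v ++ alt f g (suc k))      ≡⟨ ℓ-++-alt v (ascent⇒Pos v s s-ascent) (ascent⇒Pos v s′ s′-ascent) start (suc k) atMost ⟩
        ℓ v ℕ.+ suc k                 ≡⟨ trans (ℕP.+-suc (ℓ v) k) (cong suc (sym ℓw≡)) ⟩
        suc (ℓ w)                     ∎
        where open ≡-Reasoning
    k≤ : k ≤ ℓ (alt f g k)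
    k≤ = suffix-ℓ≥-length v (alt f g k) w≃ ℓw≡
    from-order : (order ≡ infinite) ⊎ Σ ℕ (λ m₁ → order ≡ finite m₁) → TwoDescents w
    from-order (inj₁ e) = ⊥-elim (¬AtMost (subst (λ o → AtMost o (suc k)) (sym e) tt))
    from-order (inj₂ (m₁ , e)) with ℕP.<-cmp k (suc m₁)
    ... | tri< k<1+m₁ _ _ = ⊥-elim (¬AtMost (subst (λ o → AtMost o (suc k)) (sym e) k<1+m₁))
    ... | tri≈ _ k≡ _ = record
      { m₁ = m₁ ; finite-order = e ; z = v ; b = b ; f = f ; g = g ; start = start
      ; w≃ = subst (λ t → w ≃ v ++ alt f g t) k≡ w≃ ; ℓw≡ = subst (λ t → ℓ w ≡ ℓ v ℕ.+ t) k≡ ℓw≡ }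
    ... | tri> _ _ 1+m₁<k = ⊥-elim (ℕP.<-irrefl refl (ℕP.<-≤-trans (R.ℓ-alt-beyond-order e start k 1+m₁<k) k≤))
-- The coroot action is a representation of the same group: words equal on the root lattice are
-- equal on the coroot lattice. By Matsumoto's argument, two reduced words for the same element are
-- connected by braid relations, and these hold for the transposed matrix as well.
module Faithful {n : ℕ} (A : GCM n) where
  open GCM A
  open Action A
  open Weyl A
  open Positivity A
  module Wᵀ = Weyl (transpose A)

  infix 4 _≃ᵀ_
  _≃ᵀ_ : Word n → Word n → Set
  _≃ᵀ_ = Wᵀ._≃_

  Matsumoto : ℕ → Set
  Matsumoto k = ∀ u v → length u ≡ k → length v ≡ k → ℓ u ≡ k → u ≃ v → u ≃ᵀ v

  same-last : ∀ k → Matsumoto k → ∀ u v s → length u ≡ k → length v ≡ k → ℓ (u ++ [ s ]) ≡ suc k →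
              u ++ [ s ] ≃ v ++ [ s ] → u ++ [ s ] ≃ᵀ v ++ [ s ]
  same-last k IH u v s lu lv ℓus e = Wᵀ.≃-++ʳ [ s ] (IH u v lu lv ℓu≡k u≃v)
    where
    u≃v : u ≃ v
    u≃v = ≃-trans (≃-sym (snoc-snoc≃ u s)) (≃-trans (≃-++ʳ [ s ] e) (snoc-snoc≃ v s))
    ℓu≡k : ℓ u ≡ k
    ℓu≡k = ℕP.≤-antisym (subst (ℓ u ≤_) lu (ℓ≤length u)) (ℕP.≤-pred (subst (_≤ suc (ℓ u)) ℓus (ℓ-snoc≤ u s)))

  distinct-last : ∀ k → Matsumoto k → ∀ u v s t → s ≢ t → length u ≡ k → length v ≡ k → ℓ (u ++ [ s ]) ≡ suc k →
                  u ++ [ s ] ≃ v ++ [ t ] → u ++ [ s ] ≃ᵀ v ++ [ t ]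
  distinct-last k IH u v s t s≢t lu lv ℓus e = by-last (altLast-swap start m₁)
    where
    us = u ++ [ s ]
    vt = v ++ [ t ]
    descent : ∀ y r → length y ≡ k → y ++ [ r ] ≃ us → ℓ (us ++ [ r ]) < ℓ us
    descent y r ly yr≃ = subst (ℓ (us ++ [ r ]) <_) (sym ℓus)
      (s≤s (subst (_≤ k) (sym (ℓ-cong (≃-trans (≃-++ʳ [ r ] (≃-sym yr≃)) (snoc-snoc≃ y r)))) (subst (ℓ y ≤_) ly (ℓ≤length y))))
    open Parabolic A s t s≢t
    open TwoDescents (two-descents us (descent u s lu ≃-refl) (descent v t lv (≃-sym e)))
    z′ = red z
    X : Fin n → Fin n → Word n
    X f′ g′ = z′ ++ alt f′ g′ (suc m₁)
    X≃ : X f g ≃ us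
    X≃ = ≃-trans (≃-++ʳ (alt f g (suc m₁)) (red-≃ z)) (≃-sym w≃)
    X′≃ : X g f ≃ us
    X′≃ = ≃-trans (≃-++ˡ z′ (≃-sym (R.braid-relation finite-order start))) X≃
    X≃ᵀX′ : X f g ≃ᵀ X g f
    X≃ᵀX′ = Wᵀ.≃-++ˡ z′ (Rᵀ.braid-relation finite-order start)
    X-snoc : ∀ f′ g′ → X f′ g′ ≡ (z′ ++ alt f′ g′ m₁) ++ [ altLast f′ g′ m₁ ]
    X-snoc f′ g′ = trans (cong (z′ ++_) (alt-snoc f′ g′ m₁)) (sym (LP.++-assoc z′ (alt f′ g′ m₁) _))
    reduced-X : ∀ y r f′ g′ → length y ≡ k → altLast f′ g′ m₁ ≡ r → X f′ g′ ≃ us → y ++ [ r ] ≃ us → y ++ [ r ] ≃ᵀ X f′ g′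
    reduced-X y r f′ g′ ly last≡r X≃us yr≃us = subst (y ++ [ r ] ≃ᵀ_) (sym X≡)
      (same-last k IH y (z′ ++ alt f′ g′ m₁) r ly length-prefix (trans (ℓ-cong yr≃us) ℓus)
        (subst (y ++ [ r ] ≃_) X≡ (≃-trans yr≃us (≃-sym X≃us))))
      where
      X≡ : X f′ g′ ≡ (z′ ++ alt f′ g′ m₁) ++ [ r ]
      X≡ = trans (X-snoc f′ g′) (cong (λ x → (z′ ++ alt f′ g′ m₁) ++ [ x ]) last≡r)
      length-prefix : length (z′ ++ alt f′ g′ m₁) ≡ k
      length-prefix = begin
        length (z′ ++ alt f′ g′ m₁)    ≡⟨ LP.length-++ z′ ⟩
        length z′ ℕ.+ length (alt f′ g′ m₁) ≡⟨ cong₂ ℕ._+_ (length-red z) (length-alt f′ g′ m₁) ⟩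
        ℓ z ℕ.+ m₁                     ≡⟨ ℕP.suc-injective (trans (sym (ℕP.+-suc (ℓ z) m₁)) (trans (sym ℓw≡) ℓus)) ⟩
        k                              ∎
        where open ≡-Reasoning
    finish : ∀ f₁ g₁ f₂ g₂ → altLast f₁ g₁ m₁ ≡ s → altLast f₂ g₂ m₁ ≡ t →
             X f₁ g₁ ≃ us → X f₂ g₂ ≃ us → X f₁ g₁ ≃ᵀ X f₂ g₂ → us ≃ᵀ vt
    finish f₁ g₁ f₂ g₂ last₁ last₂ X₁≃ X₂≃ X₁≃ᵀX₂ =
      Wᵀ.≃-trans (reduced-X u s f₁ g₁ lu last₁ X₁≃ ≃-refl)
        (Wᵀ.≃-trans X₁≃ᵀX₂ (Wᵀ.≃-sym (reduced-X v t f₂ g₂ lv last₂ X₂≃ (≃-sym e))))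
    by-last : (altLast f g m₁ ≡ s × altLast g f m₁ ≡ t) ⊎ (altLast f g m₁ ≡ t × altLast g f m₁ ≡ s) → us ≃ᵀ vt
    by-last (inj₁ (f-last , g-last)) = finish f g g f f-last g-last X≃ X′≃ X≃ᵀX′
    by-last (inj₂ (f-last , g-last)) = finish g f f g g-last f-last X′≃ X≃ (Wᵀ.≃-sym X≃ᵀX′)

  matsumoto : ∀ k → Matsumoto k
  matsumoto zero [] [] _ _ _ _ = Wᵀ.≃-refl
  matsumoto (suc k) u v lu lv ℓu e with snoc-decomp u lu | snoc-decomp v lv
  ... | u′ , s , refl , lu′ | v′ , t , refl , lv′ with s ≟ᶠ t
  ...   | yes refl = same-last k (matsumoto k) u′ v′ s lu′ lv′ ℓu e
  ...   | no s≢t = distinct-last k (matsumoto k) u′ v′ s t s≢t lu′ lv′ ℓu e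

  ℓ-∷ : ∀ i v → ℓ (i ∷ v) ≡ suc (ℓ v) ⊎ suc (ℓ (i ∷ v)) ≡ ℓ v
  ℓ-∷ i v with ascent-or-descent (reverse v) i
  ... | inj₁ (ℓ≡ , _) = inj₁ (trans (sym (ℓ-reverse-snoc i v)) (trans ℓ≡ (cong suc (ℓ-reverse v))))
  ... | inj₂ (ℓ≡ , _) = inj₂ (trans (cong suc (sym (ℓ-reverse-snoc i v))) (trans ℓ≡ (ℓ-reverse v)))

  reduced-word : ∀ u → Σ (Word n) λ y → length y ≡ ℓ y × y ≃ u × y ≃ᵀ u
  reduced-word [] = [] , refl , ≃-refl , Wᵀ.≃-refl
  reduced-word (i ∷ u) with reduced-word u
  ... | y , ly , y≃u , y≃ᵀu with ℓ-∷ i y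
  ...   | inj₁ ℓiy≡ = i ∷ y , trans (cong suc ly) (sym ℓiy≡) , ≃-∷ i y≃u , Wᵀ.≃-∷ i y≃ᵀu
  ...   | inj₂ ℓiy< = y′ , trans (length-red (i ∷ y)) (sym ℓy′≡) , ≃-trans (red-≃ (i ∷ y)) (≃-∷ i y≃u) , y′≃ᵀiu
    where
    y′ = red (i ∷ y)
    ℓy′≡ : ℓ y′ ≡ ℓ (i ∷ y)
    ℓy′≡ = ℓ-cong (red-≃ (i ∷ y))
    iy′≃y : i ∷ y′ ≃ y
    iy′≃y = ≃-trans (≃-∷ i (red-≃ (i ∷ y))) (ii∷≃ i y)
    iy′≃ᵀy : i ∷ y′ ≃ᵀ y
    iy′≃ᵀy = matsumoto (ℓ y) (i ∷ y′) y (trans (cong suc (length-red (i ∷ y))) ℓiy<) ly (ℓ-cong iy′≃y) iy′≃y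
    y′≃ᵀiu : y′ ≃ᵀ i ∷ u
    y′≃ᵀiu = Wᵀ.≃-trans (Wᵀ.≃-sym (Wᵀ.ii∷≃ i y′)) (Wᵀ.≃-∷ i (Wᵀ.≃-trans iy′≃ᵀy y≃ᵀu))

  ≃⇒≃ᵀ : ∀ {u v} → u ≃ v → u ≃ᵀ v
  ≃⇒≃ᵀ {u} {v} u≃v with reduced-word u | reduced-word v
  ... | yu , lu , yu≃u , yu≃ᵀu | yv , lv , yv≃v , yv≃ᵀv =
    Wᵀ.≃-trans (Wᵀ.≃-sym yu≃ᵀu) (Wᵀ.≃-trans (matsumoto (ℓ u) yu yv (trans lu (ℓ-cong yu≃u)) lv′ (ℓ-cong yu≃u) yu≃yv) yv≃ᵀv)
    where
    yu≃yv : yu ≃ yv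
    yu≃yv = ≃-trans yu≃u (≃-trans u≃v (≃-sym yv≃v))
    lv′ : length yv ≡ ℓ u
    lv′ = trans lv (trans (ℓ-cong yv≃v) (sym (ℓ-cong u≃v)))

*≡1⇒±1 : ∀ c e → c * e ≡ + 1 → c ≡ + 1 ⊎ c ≡ -1ℤ
*≡1⇒±1 c e ce≡1 with ℕP.m*n≡1⇒m≡1 ∣ c ∣ ∣ e ∣ (trans (sym (ℤP.abs-* c e)) (cong ∣_∣ ce≡1))
*≡1⇒±1 (+ .1) e _ | refl = inj₁ refl
*≡1⇒±1 -[1+ .0 ] e _ | refl = inj₂ refl

actCoroot≗actᵀ : ∀ {n} (A : GCM n) w h → actCoroot A w h ≗ Action.act (transpose A) w h
actCoroot≗actᵀ A [] h k = refl
actCoroot≗actᵀ A (i ∷ w) h k =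
  trans (cong (λ t → c k - t * δ i k) (Σ-cong (λ k′ → ℤP.*-comm (c k′) (GCM.a A k′ i))))
        (Action.reflect-cong (transpose A) i (actCoroot≗actᵀ A w h) k)
  where c = actCoroot A w h

module Roots {n : ℕ} (A : GCM n) where
  open GCM A
  open Action A
  open Weyl A
  open Positivity A
  open Faithful A
  module Aᵀ = Action (transpose A)

  coact : Word n → Vector ℤ n → Vector ℤ n
  coact = Aᵀ.act

  actCorootᵀ≗act : ∀ w h → actCoroot (transpose A) w h ≗ act w h
  actCorootᵀ≗act = actCoroot≗actᵀ (transpose A)

  act-reverse-δ : ∀ g j l → act g (δ j) ≗ δ l → act (reverse g) (δ l) ≗ δ j
  act-reverse-δ g j l gαⱼ≗αₗ k = trans (act-cong (reverse g) (sym ∘ gαⱼ≗αₗ) k) (act-reverse-act g (δ j) k)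

  -- t = s_l · s_{g αⱼ} moves every α_i (i ≢ l) only along α_l and fixes α_l, so it has no simple
  -- inversion and is trivial.
  reflWord-simple : ∀ g j l → act g (δ j) ≗ δ l → reflWord g j ≃ [ l ]
  reflWord-simple g j l gαⱼ≗αₗ = ≃-trans (≃-sym (ii∷≃ l W)) (≃-∷ l (all-Pos⇒≃[] t t-Pos))
    where
    W = reflWord g j
    t = l ∷ W
    c = actCoroot A g (δ j)
    act-W : ∀ μ → act W μ ≗ μ +ᵛ (- pairing c μ) ·ᵛ δ l
    act-W μ k = trans (act-reflWord g j μ k) (cong (λ z → μ k + (- pairing c μ) * z) (gαⱼ≗αₗ k))
    t-off-l : ∀ i k → l ≢ k → act t (δ i) k ≡ δ i k
    t-off-l i k l≢k = begin
        act W (δ i) k - pair l (act W (δ i)) * δ l k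
      ≡⟨ cong₂ (λ u v → u - pair l (act W (δ i)) * v) (act-W (δ i) k) (δ-≢ l≢k) ⟩
        δ i k + (- pairing c (δ i)) * δ l k - pair l (act W (δ i)) * + 0
      ≡⟨ cong (λ v → δ i k + (- pairing c (δ i)) * v - pair l (act W (δ i)) * + 0) (δ-≢ l≢k) ⟩
        δ i k + (- pairing c (δ i)) * + 0 - pair l (act W (δ i)) * + 0
      ≡⟨ solve 3 (λ d p q → d :+ p :* con (+ 0) :- q :* con (+ 0) := d) refl (δ i k) (- pairing c (δ i)) (pair l (act W (δ i))) ⟩
        δ i k
      ∎ where open ≡-Reasoning
    t-αₗ : act t (δ l) ≗ δ l
    t-αₗ k = begin
        reflect l (act W (δ l)) k
      ≡⟨ reflect-cong l (act-++ g (j ∷ reverse g) (δ l)) k ⟩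
        reflect l (act g (reflect j (act (reverse g) (δ l)))) k
      ≡⟨ reflect-cong l (act-cong g (reflect-cong j (act-reverse-δ g j l gαⱼ≗αₗ))) k ⟩
        reflect l (act g (reflect j (δ j))) k
      ≡⟨ reflect-cong l (act-cong g (reflect-δ j)) k ⟩
        reflect l (act g (-1ℤ ·ᵛ δ j)) k
      ≡⟨ reflect-cong l (act-· g -1ℤ (δ j)) k ⟩
        reflect l (-1ℤ ·ᵛ act g (δ j)) k
      ≡⟨ reflect-cong l (cong (-1ℤ *_) ∘ gαⱼ≗αₗ) k ⟩
        reflect l (-1ℤ ·ᵛ δ l) k
      ≡⟨ reflect-· l -1ℤ (δ l) k ⟩
        -1ℤ * reflect l (δ l) k
      ≡⟨ cong (-1ℤ *_) (reflect-δ l k) ⟩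
        -1ℤ * (-1ℤ * δ l k)
      ≡⟨ solve 1 (λ d → con -1ℤ :* (con -1ℤ :* d) := d) refl (δ l k) ⟩
        δ l k
      ∎ where open ≡-Reasoning
    t-Pos : ∀ i → Pos (act t (δ i))
    t-Pos i with l ≟ᶠ i
    ... | yes refl = λ k → subst (+ 0 ℤ.≤_) (sym (t-αₗ k)) (δ-nonneg l k)
    ... | no l≢i with Pos-or-Neg t i
    ...   | inj₁ pos = pos
    ...   | inj₂ neg with +≤+ () ← subst (ℤ._≤ + 0) (trans (t-off-l i i l≢i) (δ-refl i)) (neg i)

  -- The coroot side of `reflWord-simple`: by faithfulness s_{g αⱼ} = s_l also on coroots, and
  -- evaluating the reflection formula there at α_l^∨ gives 2 (g αⱼ^∨) = 2 α_l^∨.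
  coact-δ : ∀ g j l → act g (δ j) ≗ δ l → coact g (δ j) ≗ δ l
  coact-δ g j l gαⱼ≗αₗ k = ℤP.*-cancelˡ-≡ (+ 2) (coact g (δ j) k) (δ l k) (begin
      + 2 * coact g (δ j) k
    ≡⟨ solve 2 (λ d c → con (+ 2) :* c := d :- (d :+ (:- con (+ 2)) :* c)) refl (δ l k) (coact g (δ j) k) ⟩
      δ l k - (δ l k + (- (+ 2)) * coact g (δ j) k)
    ≡⟨ cong (λ z → δ l k - (δ l k + (- z) * coact g (δ j) k)) (sym pairing≡2) ⟩
      δ l k - (δ l k + (- Aᵀ.pairing h (δ l)) * coact g (δ j) k)
    ≡⟨ cong (_-_ (δ l k)) (sym (Aᵀ.act-reflWord g j (δ l) k)) ⟩
      δ l k - Aᵀ.act (reflWord g j) (δ l) k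
    ≡⟨ cong (_-_ (δ l k)) (Wᵀ.≃-act (≃⇒≃ᵀ (reflWord-simple g j l gαⱼ≗αₗ)) (δ l) k) ⟩
      δ l k - Aᵀ.reflect l (δ l) k
    ≡⟨ cong (_-_ (δ l k)) (Aᵀ.reflect-δ l k) ⟩
      δ l k - -1ℤ * δ l k
    ≡⟨ solve 1 (λ d → d :- con -1ℤ :* d := con (+ 2) :* d) refl (δ l k) ⟩
      + 2 * δ l k
    ∎)
    where
    open ≡-Reasoning
    h = actCoroot (transpose A) g (δ j)
    pairing≡2 : Aᵀ.pairing h (δ l) ≡ + 2
    pairing≡2 = trans (Aᵀ.pairing-congˡ (δ l) (λ k′ → trans (actCorootᵀ≗act g (δ j) k′) (gαⱼ≗αₗ k′)))
                      (trans (Aᵀ.pairing-δ l (δ l)) (trans (Aᵀ.pair-δ l l) (diag l)))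

  ±-multiple : ∀ w j k c → act w (δ j) ≗ c ·ᵛ δ k → c ≡ + 1 ⊎ c ≡ -1ℤ
  ±-multiple w j k c wαⱼ≗cαₖ = *≡1⇒±1 c (act (reverse w) (δ k) j) (sym (begin
      + 1                               ≡⟨ sym (δ-refl j) ⟩
      δ j j                             ≡⟨ sym (act-reverse-act w (δ j) j) ⟩
      act (reverse w) (act w (δ j)) j   ≡⟨ act-cong (reverse w) wαⱼ≗cαₖ j ⟩
      act (reverse w) (c ·ᵛ δ k) j      ≡⟨ act-· (reverse w) c (δ k) j ⟩
      c * act (reverse w) (δ k) j       ∎))
    where open ≡-Reasoning

  Pos-simple : ∀ w j k → Pos (act w (δ j)) → Neg (reflect k (act w (δ j))) → act w (δ j) ≗ δ k
  Pos-simple w j k pos neg = from-± (±-multiple w j k (γ k) γ≗)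
    where
    γ = act w (δ j)
    γ-off-k : ∀ k′ → k ≢ k′ → γ k′ ≡ + 0
    γ-off-k k′ k≢k′ = ℤP.≤-antisym
      (subst (ℤ._≤ + 0) (trans (cong (λ z → γ k′ - pair k γ * z) (δ-≢ k≢k′)) (solve 2 (λ g p → g :- p :* con (+ 0) := g) refl (γ k′) (pair k γ))) (neg k′))
      (pos k′)
    γ≗ : γ ≗ γ k ·ᵛ δ k
    γ≗ k′ with k ≟ᶠ k′
    ... | yes refl = sym (ℤP.*-identityʳ (γ k))
    ... | no k≢k′ = trans (γ-off-k k′ k≢k′) (sym (ℤP.*-zeroʳ (γ k)))
    from-± : γ k ≡ + 1 ⊎ γ k ≡ -1ℤ → γ ≗ δ k
    from-± (inj₁ γₖ≡1) k′ = trans (γ≗ k′) (trans (cong (_* δ k k′) γₖ≡1) (ℤP.*-identityˡ (δ k k′)))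
    from-± (inj₂ γₖ≡-1) with () ← subst (+ 0 ℤ.≤_) γₖ≡-1 (pos k)

  act-reflWord-root : ∀ x j → act (reflWord x j) (act x (δ j)) ≗ -1ℤ ·ᵛ act x (δ j)
  act-reflWord-root x j k = begin
      act (x ++ j ∷ reverse x) (act x (δ j)) k
    ≡⟨ act-++ x (j ∷ reverse x) (act x (δ j)) k ⟩
      act x (reflect j (act (reverse x) (act x (δ j)))) k
    ≡⟨ act-cong x (reflect-cong j (act-reverse-act x (δ j))) k ⟩
      act x (reflect j (δ j)) k
    ≡⟨ act-cong x (reflect-δ j) k ⟩
      act x (-1ℤ ·ᵛ δ j) k
    ≡⟨ act-· x -1ℤ (δ j) k ⟩
      -1ℤ * act x (δ j) k
    ∎ where open ≡-Reasoning

  reflWord-involutive : ∀ x j → reflWord x j ++ reflWord x j ≃ []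
  reflWord-involutive x j = begin
    (x ++ j ∷ reverse x) ++ x ++ j ∷ reverse x    ≡⟨ LP.++-assoc x (j ∷ reverse x) (reflWord x j) ⟩
    x ++ j ∷ (reverse x ++ x ++ j ∷ reverse x)    ≡⟨ cong (λ z → x ++ j ∷ z) (LP.++-assoc (reverse x) x (j ∷ reverse x)) ⟨
    x ++ j ∷ ((reverse x ++ x) ++ j ∷ reverse x)  ≈⟨ ≃-++ˡ x (≃-∷ j (≃-++ʳ (j ∷ reverse x) (inverseˡ x))) ⟩
    x ++ j ∷ j ∷ reverse x                        ≈⟨ ≃-++ˡ x (ii∷≃ j (reverse x)) ⟩
    x ++ reverse x                                ≈⟨ inverseʳ x ⟩
    []                                            ∎
    where open ≃-Reasoning

  record Exchange (y x : Word n) (j : Fin n) : Set where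
    field
      p : Word n
      k : Fin n
      q : Word n
      y≡ : y ≡ p ++ k ∷ q
      y·t≃ : y ++ reflWord x j ≃ p ++ q

  exchange : ∀ y x j → Pos (act x (δ j)) → Neg (act y (act x (δ j))) → Exchange y x j
  exchange [] x j pos neg = ⊥-elim (root-not-Pos-and-Neg x j pos neg)
  exchange (k ∷ q) x j pos neg with Pos-or-Neg (q ++ x) j
  ... | inj₂ qxαⱼ-neg = record { p = k ∷ p ; k = k′ ; q = q′ ; y≡ = cong (k ∷_) y≡ ; y·t≃ = ≃-∷ k y·t≃ }
    where
    open Exchange (exchange q x j pos (λ k″ → subst (ℤ._≤ + 0) (act-++ q x (δ j) k″) (qxαⱼ-neg k″))) renaming (k to k′; q to q′)
  ... | inj₁ qxαⱼ-pos = record { p = [] ; k = k ; q = q ; y≡ = refl ; y·t≃ = kqT≃q }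
    where
    T = reflWord x j
    qx-simple : reflWord (q ++ x) j ≃ [ k ]
    qx-simple = reflWord-simple (q ++ x) j k (Pos-simple (q ++ x) j k qxαⱼ-pos
      (λ k″ → subst (ℤ._≤ + 0) (reflect-cong k (sym ∘ act-++ q x (δ j)) k″) (neg k″)))
    reflWord-++ : reflWord (q ++ x) j ≡ q ++ T ++ reverse q
    reflWord-++ = trans (LP.++-assoc q x (j ∷ reverse (q ++ x)))
      (cong (q ++_) (trans (cong (λ r → x ++ j ∷ r) (LP.reverse-++ q x)) (sym (LP.++-assoc x (j ∷ reverse x) (reverse q)))))
    regroup : (q ++ T) ++ reverse q ++ q ≡ reflWord (q ++ x) j ++ q
    regroup = begin
      (q ++ T) ++ reverse q ++ q              ≡⟨ LP.++-assoc q T (reverse q ++ q) ⟩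
      q ++ T ++ reverse q ++ q                ≡⟨ cong (q ++_) (LP.++-assoc T (reverse q) q) ⟨
      q ++ (T ++ reverse q) ++ q              ≡⟨ LP.++-assoc q (T ++ reverse q) q ⟨
      (q ++ T ++ reverse q) ++ q              ≡⟨ cong (_++ q) reflWord-++ ⟨
      reflWord (q ++ x) j ++ q                ∎
      where open ≡-Reasoning
    qT≃kq : q ++ T ≃ k ∷ q
    qT≃kq = begin
      q ++ T                                  ≡⟨ LP.++-identityʳ (q ++ T) ⟨
      (q ++ T) ++ []                          ≈⟨ ≃-++ˡ (q ++ T) (inverseˡ q) ⟨
      (q ++ T) ++ reverse q ++ q              ≡⟨ regroup ⟩
      reflWord (q ++ x) j ++ q                ≈⟨ ≃-++ʳ q qx-simple ⟩
      k ∷ q                                   ∎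
      where open ≃-Reasoning
    kqT≃q : (k ∷ q) ++ T ≃ [] ++ q
    kqT≃q = ≃-trans (≃-∷ k qT≃kq) (ii∷≃ k q)

  -- If x αⱼ and y α_l are positive roots with the same reflection, then z = y⁻¹ x sends αⱼ to a
  -- multiple of α_l (the reflection formula gives 2 x αⱼ = ⟨y α_l^∨ , x αⱼ⟩ y α_l), hence to α_l;
  -- `coact-δ` then identifies the coroots.
  coroot-unique : ∀ x j y l → reflWord x j ≃ reflWord y l → Pos (act x (δ j)) → Pos (act y (δ l)) →
                  coact x (δ j) ≗ coact y (δ l)
  coroot-unique x j y l same pos-x pos-y = from-± (±-multiple z j l (ρ l) zαⱼ≗)
    where
    β = act x (δ j)
    γ = act y (δ l)
    P = pairing (actCoroot A y (δ l)) β
    z = reverse y ++ x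
    ρ = act (reverse y) β
    2β≡Pγ : ∀ k → + 2 * β k ≡ P * γ k
    2β≡Pγ k = begin
        + 2 * β k
      ≡⟨ solve 1 (λ r → con (+ 2) :* r := r :- con -1ℤ :* r) refl (β k) ⟩
        β k - -1ℤ * β k
      ≡⟨ cong (_-_ (β k)) (sym (act-reflWord-root x j k)) ⟩
        β k - act (reflWord x j) β k
      ≡⟨ cong (_-_ (β k)) (≃-act same β k) ⟩
        β k - act (reflWord y l) β k
      ≡⟨ cong (_-_ (β k)) (act-reflWord y l β k) ⟩
        β k - (β k + (- P) * γ k)
      ≡⟨ solve 3 (λ r p s → r :- (r :+ (:- p) :* s) := p :* s) refl (β k) P (γ k) ⟩
        P * γ k
      ∎ where open ≡-Reasoning
    2ρ≡Pαₗ : ∀ k → + 2 * ρ k ≡ P * δ l k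
    2ρ≡Pαₗ k = begin
        + 2 * ρ k                        ≡⟨ sym (act-· (reverse y) (+ 2) β k) ⟩
        act (reverse y) (+ 2 ·ᵛ β) k     ≡⟨ act-cong (reverse y) 2β≡Pγ k ⟩
        act (reverse y) (P ·ᵛ γ) k       ≡⟨ act-· (reverse y) P γ k ⟩
        P * act (reverse y) γ k          ≡⟨ cong (P *_) (act-reverse-act y (δ l) k) ⟩
        P * δ l k                        ∎
      where open ≡-Reasoning
    zαⱼ≗ : act z (δ j) ≗ ρ l ·ᵛ δ l
    zαⱼ≗ k with l ≟ᶠ k
    ... | yes refl = trans (act-++ (reverse y) x (δ j) l) (sym (ℤP.*-identityʳ (ρ l)))
    ... | no l≢k = trans (act-++ (reverse y) x (δ j) k)
                     (trans (ℤP.*-cancelˡ-≡ (+ 2) (ρ k) (+ 0) (trans (2ρ≡Pαₗ k) (trans (cong (P *_) (δ-≢ l≢k)) (ℤP.*-zeroʳ P))))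
                            (sym (ℤP.*-zeroʳ (ρ l))))
    from-± : ρ l ≡ + 1 ⊎ ρ l ≡ -1ℤ → coact x (δ j) ≗ coact y (δ l)
    from-± (inj₂ ρₗ≡-1) = ⊥-elim (root-not-Pos-and-Neg x j pos-x β-neg)
      where
      β≡-γ : ∀ k → β k ≡ -1ℤ * γ k
      β≡-γ k = begin
          β k                          ≡⟨ sym (act-act-reverse y β k) ⟩
          act y ρ k                    ≡⟨ act-cong y (λ k′ → trans (sym (act-++ (reverse y) x (δ j) k′)) (trans (zαⱼ≗ k′) (cong (_* δ l k′) ρₗ≡-1))) k ⟩
          act y (-1ℤ ·ᵛ δ l) k         ≡⟨ act-· y -1ℤ (δ l) k ⟩
          -1ℤ * γ k                    ∎
        where open ≡-Reasoning
      β-neg : Neg β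
      β-neg k = subst (ℤ._≤ + 0) (sym (β≡-γ k))
        (neg-nonneg⇒nonpos (subst (+ 0 ℤ.≤_) (sym (solve 1 (λ t → :- (con -1ℤ :* t) := t) refl (γ k))) (pos-y k)))
    from-± (inj₁ ρₗ≡1) k = begin
        coact x (δ j) k
      ≡⟨ sym (Aᵀ.act-act-reverse y (coact x (δ j)) k) ⟩
        coact y (coact (reverse y) (coact x (δ j))) k
      ≡⟨ Aᵀ.act-cong y (sym ∘ Aᵀ.act-++ (reverse y) x (δ j)) k ⟩
        coact y (coact z (δ j)) k
      ≡⟨ Aᵀ.act-cong y (coact-δ z j l (λ k′ → trans (zαⱼ≗ k′) (trans (cong (_* δ l k′) ρₗ≡1) (ℤP.*-identityˡ (δ l k′))))) k ⟩
        coact y (δ l) k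
      ∎ where open ≡-Reasoning

module Deduplicate {X : Set} (R : X → X → Set) (R? : ∀ a b → Dec (R a b)) (R-equiv : IsEquivalence R) where
  open IsEquivalence R-equiv using () renaming (refl to R-refl; sym to R-sym; trans to R-trans)

  ∈-deduplicate⁻ : ∀ xs {y} → y ∈ deduplicate R? xs → y ∈ xs
  ∈-deduplicate⁻ (x ∷ xs) (here e) = here e
  ∈-deduplicate⁻ (x ∷ xs) (there p) = there (∈-deduplicate⁻ xs (proj₁ (∈-filter⁻ (¬? ∘ R? x) {xs = deduplicate R? xs} p)))

  deduplicate-distinct : ∀ xs → AllPairs (λ a b → ¬ R a b) (deduplicate R? xs)
  deduplicate-distinct [] = []
  deduplicate-distinct (x ∷ xs) = AllP.all-filter (¬? ∘ R? x) (deduplicate R? xs) ∷ APP.filter⁺ (¬? ∘ R? x) (deduplicate-distinct xs)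

  deduplicate-covers : ∀ xs {y} → y ∈ xs → Σ X λ u → u ∈ deduplicate R? xs × R u y
  deduplicate-covers (x ∷ xs) (here refl) = x , here refl , R-refl
  deduplicate-covers (x ∷ xs) (there p) with deduplicate-covers xs p
  ... | u , u∈ , Ruy with R? x u
  ...   | yes Rxu = x , here refl , R-trans Rxu Ruy
  ...   | no ¬Rxu = u , there (∈-filter⁺ (¬? ∘ R? x) u∈ ¬Rxu) , Ruy

  sumWhere : (X → ℤ) → X → List X → ℤ
  sumWhere F y L = sumℤ (List.map (λ u → if does (R? u y) then F u else + 0) L)

  sumWhere-none : ∀ F y L → (∀ u → u ∈ L → ¬ R u y) → sumWhere F y L ≡ + 0
  sumWhere-none F y [] _ = refl
  sumWhere-none F y (a ∷ L) none with R? a y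
  ... | yes Ray = ⊥-elim (none a (here refl) Ray)
  ... | no _ = trans (ℤP.+-identityˡ _) (sumWhere-none F y L (λ u u∈ → none u (there u∈)))

  sumWhere-unique : ∀ F y L → (∀ {u u′} → R u u′ → F u ≡ F u′) → AllPairs (λ a b → ¬ R a b) L →
                    (Σ X λ u → u ∈ L × R u y) → sumWhere F y L ≡ F y
  sumWhere-unique F y (a ∷ L) F-resp (a∉L ∷ distinct) (u , u∈ , Ruy) with R? a y
  ... | yes Ray = trans (cong (_+_ (F a)) (sumWhere-none F y L (λ u′ u′∈ Ru′y → All.lookup a∉L u′∈ (R-trans Ray (R-sym Ru′y)))))
                        (trans (ℤP.+-identityʳ (F a)) (F-resp Ray))
  ... | no ¬Ray with u∈
  ...   | here refl = ⊥-elim (¬Ray Ruy)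
  ...   | there u∈L = trans (ℤP.+-identityˡ _) (sumWhere-unique F y L F-resp distinct (u , u∈L , Ruy))

sumℤ-map-cong : ∀ {X : Set} (L : List X) {f g : X → ℤ} → f ≗ g → sumℤ (List.map f L) ≡ sumℤ (List.map g L)
sumℤ-map-cong L f≗g = cong sumℤ (LP.map-cong f≗g L)

sumℤ-Σ-comm : ∀ {X : Set} {n} (L : List X) (G : X → Fin n → ℤ) →
              sumℤ (List.map (λ u → Σ[ n ] (G u)) L) ≡ Σ[ n ] (λ i → sumℤ (List.map (λ u → G u i) L))
sumℤ-Σ-comm {n = n} [] G = sym (Σ-zero n)
sumℤ-Σ-comm {n = n} (a ∷ L) G = trans (cong (_+_ (Σ[ n ] (G a))) (sumℤ-Σ-comm L G))
                                      (sym (Σ-distrib-+ (G a) (λ i → sumℤ (List.map (λ u → G u i) L))))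
module StrongEdges {n : ℕ} (A : GCM n) (Λ : Fin n → ℕ) where
  open GCM A
  open Action A
  open Weyl A
  open Positivity A
  open Faithful A
  open Roots A

  Edge : Word n → Word n → ℤ → Set
  Edge = StrongEdge A Λ

  edge-unique : ∀ {v u m₁ m₂} → Edge v u m₁ → Edge v u m₂ → m₁ ≡ m₂
  edge-unique {v} {u} (_ , x , j , u≈₁ , pos₁ , m₁≡) (_ , y , l , u≈₂ , pos₂ , m₂≡) =
    trans m₁≡ (trans (Σ-cong (λ k → cong (_* + Λ k) (coroot≡ k))) (sym m₂≡))
    where
    same-reflection : reflWord x j ≃ reflWord y l
    same-reflection = ≃-cancelˡ v (≃-trans (≃-sym (mk≃ {u} {v ++ reflWord x j} u≈₁)) (mk≃ {u} {v ++ reflWord y l} u≈₂))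
    coroot≡ : actCoroot A x (δ j) ≗ actCoroot A y (δ l)
    coroot≡ k = trans (actCoroot≗actᵀ A x (δ j) k)
                  (trans (coroot-unique x j y l same-reflection pos₁ pos₂ k) (sym (actCoroot≗actᵀ A y (δ l) k)))

  edge-resp : ∀ {v u v′ u′ m} → v ≃ v′ → u ≃ u′ → Edge v u m → Edge v′ u′ m
  edge-resp {v} {u} v≃v′ u≃u′ (ℓu≡ , x , j , u≈ , pos , m≡) =
    trans (sym (ℓ-cong u≃u′)) (trans ℓu≡ (cong suc (ℓ-cong v≃v′))) , x , j ,
    un≃ (≃-trans (≃-sym u≃u′) (≃-trans (mk≃ u≈) (≃-++ʳ (reflWord x j) v≃v′))) , pos , m≡

  length-delete : ∀ (p q : Word n) k → length (p ++ k ∷ q) ≡ suc (length (p ++ q))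
  length-delete p q k = trans (LP.length-++ p) (trans (ℕP.+-suc (length p) (length q)) (cong suc (sym (LP.length-++ p))))

  exchange-shortens : ∀ y x j → Pos (act x (δ j)) → Neg (act y (act x (δ j))) → suc (ℓ (y ++ reflWord x j)) ≤ length y
  exchange-shortens y x j pos neg = subst (suc (ℓ (y ++ reflWord x j)) ≤_) (sym (trans (cong length y≡) (length-delete p q k)))
    (s≤s (subst (_≤ length (p ++ q)) (sym (ℓ-cong y·t≃)) (ℓ≤length (p ++ q))))
    where open Exchange (exchange y x j pos neg)

  reflWord-cancelʳ : ∀ y x j → (y ++ reflWord x j) ++ reflWord x j ≃ y
  reflWord-cancelʳ y x j = begin
    (y ++ reflWord x j) ++ reflWord x j    ≡⟨ LP.++-assoc y (reflWord x j) (reflWord x j) ⟩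
    y ++ (reflWord x j ++ reflWord x j)    ≈⟨ ≃-++ˡ y (reflWord-involutive x j) ⟩
    y ++ []                                ≡⟨ LP.++-identityʳ y ⟩
    y                                      ∎
    where open ≃-Reasoning

  2+n≰n : ∀ {m} → suc (suc m) ≤ m → ⊥
  2+n≰n 2+m≤m = ℕP.1+n≰n (ℕP.≤-trans (ℕP.n≤1+n _) 2+m≤m)

  upward-Pos : ∀ v x j → Pos (act x (δ j)) → ℓ (v ++ reflWord x j) ≡ suc (ℓ v) → Pos (act v (act x (δ j)))
  upward-Pos v x j β-pos ℓ-vt with Pos-or-Neg (v ++ x) j
  ... | inj₁ vxαⱼ-pos = λ k → subst (+ 0 ℤ.≤_) (act-++ v x (δ j) k) (vxαⱼ-pos k)
  ... | inj₂ vxαⱼ-neg = ⊥-elim (2+n≰n (subst₂ _≤_ (cong suc ℓ-red-vt) (length-red v)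
          (exchange-shortens (red v) x j β-pos (λ k → subst (ℤ._≤ + 0) (trans (act-++ v x (δ j) k) (sym (≃-act (red-≃ v) _ k))) (vxαⱼ-neg k)))))
    where
    ℓ-red-vt : ℓ (red v ++ reflWord x j) ≡ suc (ℓ v)
    ℓ-red-vt = trans (ℓ-cong (≃-++ʳ (reflWord x j) (red-≃ v))) ℓ-vt

  -- An edge v → s_i w = v t (t the reflection of β = x αⱼ > 0) has v β > 0, so (s_i w) β < 0, and
  -- the exchange condition deletes a letter of i ∷ red w: deleting i gives v ≃ w, any other letter
  -- makes s_i v shorter than v.
  no-edge-to-ascent : ∀ v w i → ¬ v ≃ w → ℓ (i ∷ v) ≡ suc (ℓ v) → ℓ (i ∷ w) ≡ suc (ℓ w) → ∀ m → ¬ Edge v (i ∷ w) m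
  no-edge-to-ascent v w i v≄w iv-ascent iw-ascent m (ℓ≡ , x , j , iw≈ , β-pos , _) =
    deleted (exchange u x j β-pos uβ-neg)
    where
    u = i ∷ red w
    β = act x (δ j)
    t = reflWord x j
    u≃vt : u ≃ v ++ t
    u≃vt = ≃-trans (≃-∷ i (red-≃ w)) (mk≃ {i ∷ w} {v ++ t} iw≈)
    uβ-neg : Neg (act u β)
    uβ-neg k = neg-nonneg⇒nonpos (subst (+ 0 ℤ.≤_) eq (upward-Pos v x j β-pos (trans (ℓ-cong (≃-sym u≃vt)) (trans (ℓ-cong (≃-∷ i (red-≃ w))) ℓ≡)) k))
      where
      eq : act v β k ≡ - act u β k
      eq = begin
        act v β k                          ≡⟨ sym (ℤP.neg-involutive _) ⟩
        - (- act v β k)                    ≡⟨ cong -_ (sym (ℤP.-1*i≡-i _)) ⟩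
        - (-1ℤ * act v β k)                ≡⟨ cong -_ (sym (act-· v -1ℤ β k)) ⟩
        - act v (-1ℤ ·ᵛ β) k               ≡⟨ cong -_ (sym (act-cong v (act-reflWord-root x j) k)) ⟩
        - act v (act t β) k                ≡⟨ cong -_ (sym (act-++ v t β k)) ⟩
        - act (v ++ t) β k                 ≡⟨ cong -_ (sym (≃-act u≃vt β k)) ⟩
        - act u β k                        ∎
        where open ≡-Reasoning
    ut≃v : u ++ t ≃ v
    ut≃v = ≃-trans (≃-++ʳ {u} {v ++ t} t u≃vt) (reflWord-cancelʳ v x j)
    deleted : Exchange u x j → ⊥
    deleted record { p = [] ; q = q ; y≡ = u≡ ; y·t≃ = ut≃q } =
      v≄w (≃-trans (≃-sym ut≃v) (≃-trans ut≃q (subst (_≃ w) (proj₂ (LP.∷-injective u≡)) (red-≃ w))))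
    deleted record { p = i′ ∷ p ; k = k ; q = q ; y≡ = u≡ ; y·t≃ = ut≃ } =
      2+n≰n (ℕP.≤-trans (s≤s (subst (_≤ length (p ++ q)) iv-ascent (len-minimal (≃-sym iv≃)))) (ℕP.≤-reflexive ℓ≡ℓv))
      where
      iv≃ : i ∷ v ≃ p ++ q
      iv≃ = ≃-trans (≃-∷ i (≃-trans (≃-sym ut≃v) ut≃))
                    (subst (λ z → i ∷ z ∷ (p ++ q) ≃ p ++ q) (proj₁ (LP.∷-injective u≡)) (ii∷≃ i (p ++ q)))
      ℓ≡ℓv : suc (length (p ++ q)) ≡ ℓ v
      ℓ≡ℓv = trans (sym (length-delete p q k))
               (trans (cong length (sym (proj₂ (LP.∷-injective u≡))))
                 (trans (length-red w) (ℕP.suc-injective (trans (sym iw-ascent) ℓ≡))))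

  no-edge-from-descent : ∀ v w i → ¬ v ≃ w → suc (ℓ (i ∷ v)) ≡ ℓ v → suc (ℓ (i ∷ w)) ≡ ℓ w → ∀ m → ¬ Edge (i ∷ v) w m
  no-edge-from-descent v w i v≄w iv-descent iw-descent m e =
    no-edge-to-ascent (i ∷ v) (i ∷ w) i (v≄w ∘ ≃-cancel-∷ i) (ascent v iv-descent) (ascent w iw-descent) m
      (edge-resp {i ∷ v} {w} {i ∷ v} {i ∷ i ∷ w} ≃-refl (≃-sym (ii∷≃ i w)) e)
    where
    ascent : ∀ y → suc (ℓ (i ∷ y)) ≡ ℓ y → ℓ (i ∷ i ∷ y) ≡ suc (ℓ (i ∷ y))
    ascent y descent = trans (ℓ-cong (ii∷≃ i y)) (sym descent)

  edge-shift : ∀ {v w i m} → ℓ (i ∷ w) ≡ suc (ℓ w) → ℓ v ≡ suc (ℓ (i ∷ v)) → Edge v (i ∷ w) m → Edge (i ∷ v) w m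
  edge-shift {v} {w} {i} iw-ascent iv-descent (ℓ≡ , x , j , iw≈ , pos , m≡) =
    trans (ℕP.suc-injective (trans (sym iw-ascent) ℓ≡)) iv-descent , x , j ,
    un≃ (≃-trans (≃-sym (ii∷≃ i w)) (≃-∷ i (mk≃ {i ∷ w} {v ++ reflWord x j} iw≈))) , pos , m≡

  edge-unshift : ∀ {v w i m} → ℓ (i ∷ w) ≡ suc (ℓ w) → ℓ v ≡ suc (ℓ (i ∷ v)) → Edge (i ∷ v) w m → Edge v (i ∷ w) m
  edge-unshift {v} {w} {i} iw-ascent iv-descent (ℓ≡ , x , j , w≈ , pos , m≡) =
    trans iw-ascent (cong suc (trans ℓ≡ (sym iv-descent))) , x , j ,
    un≃ (≃-trans (≃-∷ i (mk≃ {w} {(i ∷ v) ++ reflWord x j} w≈)) (ii∷≃ i (v ++ reflWord x j))) , pos , m≡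

  edgeWeight : Word n → Fin n → ℤ
  edgeWeight v i = Σ[ n ] (λ k → actCoroot A (reverse v) (δ i) k * + Λ k)

  ascent-edge : ∀ v i → ℓ (i ∷ v) ≡ suc (ℓ v) → Edge v (i ∷ v) (edgeWeight v i)
  ascent-edge v i ascent = ascent , reverse v , i , un≃ (≃-sym v·t≃iv) , pos , refl
    where
    v·t≃iv : v ++ reflWord (reverse v) i ≃ i ∷ v
    v·t≃iv = begin
      v ++ (reverse v ++ i ∷ reverse (reverse v))   ≡⟨ cong (λ z → v ++ (reverse v ++ i ∷ z)) (LP.reverse-involutive v) ⟩
      v ++ (reverse v ++ i ∷ v)                     ≡⟨ LP.++-assoc v (reverse v) (i ∷ v) ⟨
      (v ++ reverse v) ++ i ∷ v                     ≈⟨ ≃-++ʳ (i ∷ v) (inverseʳ v) ⟩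
      i ∷ v                                         ∎
      where open ≃-Reasoning
    pos : Pos (act (reverse v) (δ i))
    pos = ascent⇒Pos (reverse v) i (subst₂ _≤_ (sym (ℓ-reverse v)) (sym (ℓ-reverse-snoc i v))
                                            (subst (ℓ v ≤_) (sym ascent) (ℕP.n≤1+n (ℓ v))))

  edgeWeight-∷ : ∀ v i → edgeWeight (i ∷ v) i ≡ - edgeWeight v i
  edgeWeight-∷ v i = begin
      Σ[ n ] (λ k → actCoroot A (reverse (i ∷ v)) (δ i) k * + Λ k)
    ≡⟨ Σ-cong (λ k → cong (_* + Λ k) (trans (cong (λ z → actCoroot A z (δ i) k) (LP.unfold-reverse i v)) (coroot-snoc k))) ⟩
      Σ[ n ] (λ k → (-1ℤ * c k) * + Λ k)
    ≡⟨ Σ-cong (λ k → solve 2 (λ c l → (con -1ℤ :* c) :* l := :- (c :* l)) refl (c k) (+ Λ k)) ⟩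
      Σ[ n ] (λ k → - (c k * + Λ k))
    ≡⟨ Σ-neg (λ k → c k * + Λ k) ⟩
      - edgeWeight v i
    ∎ where
      open ≡-Reasoning
      c = actCoroot A (reverse v) (δ i)
      coroot-snoc : ∀ k → actCoroot A (reverse v ++ [ i ]) (δ i) k ≡ -1ℤ * c k
      coroot-snoc k = trans (actCoroot≗actᵀ A (reverse v ++ [ i ]) (δ i) k)
                        (trans (Aᵀ.act-snoc-δ (reverse v) i k) (cong (-1ℤ *_) (sym (actCoroot≗actᵀ A (reverse v) (δ i) k))))

  descent-edge : ∀ v i → suc (ℓ (i ∷ v)) ≡ ℓ v → Edge (i ∷ v) v (- edgeWeight v i)
  descent-edge v i descent = subst (Edge (i ∷ v) v) (edgeWeight-∷ v i)
    (edge-resp {i ∷ v} {i ∷ i ∷ v} {i ∷ v} {v} ≃-refl (ii∷≃ i v) (ascent-edge (i ∷ v) i (trans (ℓ-cong (ii∷≃ i v)) (sym descent))))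

  central-fixed : ∀ K → IsCentral A K → ∀ w → Aᵀ.act w (λ k → + K k) ≗ (λ k → + K k)
  central-fixed K central [] k = refl
  central-fixed K central (i ∷ w) k = trans (Aᵀ.reflect-cong i (central-fixed K central w) k)
    (trans (cong (λ t → + K k - t * δ i k) (trans (Σ-cong (λ k′ → ℤP.*-comm (a k′ i) (+ K k′))) (central i)))
           (solve 2 (λ x d → x :- con (+ 0) :* d := x) refl (+ K k) (δ i k)))

  Σ-K-edgeWeight : ∀ K → IsCentral A K → ∀ v → Σ[ n ] (λ i → + K i * edgeWeight v i) ≡ pairKΛ A K Λ
  Σ-K-edgeWeight K central v = begin
      Σ[ n ] (λ i → + K i * Σ[ n ] (λ k → c i k * + Λ k))
    ≡⟨ Σ-cong (λ i → sym (Σ-*ˡ (+ K i) (λ k → c i k * + Λ k))) ⟩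
      Σ[ n ] (λ i → Σ[ n ] (λ k → + K i * (c i k * + Λ k)))
    ≡⟨ Σ-comm (λ i k → + K i * (c i k * + Λ k)) ⟩
      Σ[ n ] (λ k → Σ[ n ] (λ i → + K i * (c i k * + Λ k)))
    ≡⟨ Σ-cong (λ k → trans (Σ-cong (λ i → sym (ℤP.*-assoc (+ K i) (c i k) (+ Λ k)))) (Σ-*ʳ (+ Λ k) (λ i → + K i * c i k))) ⟩
      Σ[ n ] (λ k → Σ[ n ] (λ i → + K i * c i k) * + Λ k)
    ≡⟨ Σ-cong (λ k → cong (_* + Λ k) (K-fixed k)) ⟩
      Σ[ n ] (λ k → + K k * + Λ k)
    ∎ where
      open ≡-Reasoning
      c : Fin n → Fin n → ℤ
      c i = actCoroot A (reverse v) (δ i)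
      K-fixed : ∀ k → Σ[ n ] (λ i → + K i * c i k) ≡ + K k
      K-fixed k = trans (Σ-cong (λ i → cong (+ K i *_) (actCoroot≗actᵀ A (reverse v) (δ i) k)))
                        (trans (sym (Aᵀ.act-linear (reverse v) (λ k → + K k) k)) (central-fixed K central (reverse v) k))

module DualGraded {n : ℕ} (A : GCM n) (Λ K : Fin n → ℕ) (central : IsCentral A K)
                  (mS : Word n → Word n → ℤ) (isMult : IsStrongMult A Λ mS) where
  open GCM A
  open Action A
  open Weyl A
  open Faithful A using (ℓ-∷)
  open StrongEdges A Λ

  mS-edge : ∀ {v u m} → Edge v u m → mS v u ≡ m
  mS-edge {v} {u} {m} e with isMult v u
  ... | inj₁ e′ = edge-unique {v} {u} e′ e
  ... | inj₂ (no-edge , _) = ⊥-elim (no-edge (m , e))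

  mS-no-edge : ∀ v u → (∀ m → ¬ Edge v u m) → mS v u ≡ + 0
  mS-no-edge v u no-edge with isMult v u
  ... | inj₁ e = ⊥-elim (no-edge _ e)
  ... | inj₂ (_ , mS≡0) = mS≡0

  mS-resp : ∀ {v u v′ u′} → v ≃ v′ → u ≃ u′ → mS v u ≡ mS v′ u′
  mS-resp {v} {u} {v′} {u′} v≃v′ u≃u′ with isMult v u
  ... | inj₁ e = sym (mS-edge (edge-resp v≃v′ u≃u′ e))
  ... | inj₂ (no-edge , mS≡0) = trans mS≡0 (sym (mS-no-edge v′ u′ (λ m e → no-edge (m , edge-resp (≃-sym v≃v′) (≃-sym u≃u′) e))))

  open Deduplicate (_≈_ A) (_≈?_ A) ≈-isEquivalence

  ∈elemsOfLength⇒ℓ : ∀ m u → u ∈ elemsOfLength A m → ℓ u ≡ m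
  ∈elemsOfLength⇒ℓ m u u∈ = proj₂ (∈-filter⁻ (λ w → len A w ℕ.≟ m) {xs = allWords A m} (∈-deduplicate⁻ _ u∈))

  elemsOfLength-covers : ∀ m y → ℓ y ≡ m → Σ (Word n) λ u → u ∈ elemsOfLength A m × _≈_ A u y
  elemsOfLength-covers m y ℓy≡m with deduplicate-covers (filter (λ w → len A w ℕ.≟ m) (allWords A m)) red-y∈
    where
    red-y∈ : red y ∈ filter (λ w → len A w ℕ.≟ m) (allWords A m)
    red-y∈ = ∈-filter⁺ (λ w → len A w ℕ.≟ m)
      (subst (λ t → red y ∈ allWords A t) (trans (length-red y) ℓy≡m) (allWords⁺ {P = red y ≡_} (red y) refl))
      (trans (ℓ-cong (red-≃ y)) ℓy≡m)
  ... | u , u∈ , u≈red-y = u , u∈ , un≃ (≃-trans (mk≃ {u} {red y} u≈red-y) (red-≃ y))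

  sumWhere-elemsOfLength : ∀ m F y → (∀ {u u′} → _≈_ A u u′ → F u ≡ F u′) → (ℓ y ≢ m → F y ≡ + 0) →
                           sumWhere F y (elemsOfLength A m) ≡ F y
  sumWhere-elemsOfLength m F y F-resp F≡0 with ℓ y ℕ.≟ m
  ... | yes ℓy≡m = sumWhere-unique F y _ F-resp (deduplicate-distinct _) (elemsOfLength-covers m y ℓy≡m)
  ... | no ℓy≢m = trans (sumWhere-none F y _ (λ u u∈ u≈y → ℓy≢m (trans (sym (ℓ-cong (mk≃ {u} {y} u≈y))) (∈elemsOfLength⇒ℓ m u u∈))))
                        (sym (F≡0 ℓy≢m))

  elemsBelow-view : ∀ v → (ℓ v ≡ 0 × elemsBelow A v ≡ []) ⊎ Σ ℕ (λ m → ℓ v ≡ suc m × elemsBelow A v ≡ elemsOfLength A m)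
  elemsBelow-view v with len A v
  ... | zero = inj₁ (refl , refl)
  ... | suc m = inj₂ (m , refl , refl)

  upWeight : Word n → Fin n → ℤ
  upWeight w i = if does (len A (i ∷ w) ℕ.≟ suc (len A w)) then + K i else + 0

  downWeight : Word n → Fin n → ℤ
  downWeight v i = if does (len A v ℕ.≟ suc (len A (i ∷ v))) then + K i else + 0

  *-if-∧ : ∀ (x : ℤ) a b (k : ℤ) → x * (if a ∧ b then k else + 0) ≡ (if a then x * (if b then k else + 0) else + 0)
  *-if-∧ x true b k = refl
  *-if-∧ x false b k = ℤP.*-zeroʳ x

  coefDU≡Σ : ∀ v w → coefDU A mS K v w ≡ Σ[ n ] (λ i → mS v (i ∷ w) * upWeight w i)
  coefDU≡Σ v w = begin
      sumℤ (List.map (λ u → mS v u * weakMult A K w u) E)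
    ≡⟨ sumℤ-map-cong E (λ u → sym (Σ-*ˡ (mS v u) (term u))) ⟩
      sumℤ (List.map (λ u → Σ[ n ] (λ i → mS v u * term u i)) E)
    ≡⟨ sumℤ-Σ-comm E (λ u i → mS v u * term u i) ⟩
      Σ[ n ] (λ i → sumℤ (List.map (λ u → mS v u * term u i) E))
    ≡⟨ Σ-cong (λ i → trans (sumℤ-map-cong E (λ u → *-if-∧ (mS v u) _ _ (+ K i)))
                           (sumWhere-elemsOfLength (suc (ℓ v)) (λ u → mS v u * upWeight w i) (i ∷ w)
                              (λ u≈u′ → cong (_* upWeight w i) (mS-resp ≃-refl (mk≃ u≈u′)))
                              (λ ℓ≢ → trans (cong (_* upWeight w i) (mS-no-edge v (i ∷ w) (λ m e → ℓ≢ (proj₁ e))))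
                                            (ℤP.*-zeroˡ (upWeight w i))))) ⟩
      Σ[ n ] (λ i → mS v (i ∷ w) * upWeight w i)
    ∎ where
      open ≡-Reasoning
      E = elemsOfLength A (suc (ℓ v))
      term : Word n → Fin n → ℤ
      term u i = if does (_≈?_ A u (i ∷ w)) ∧ does (len A (i ∷ w) ℕ.≟ suc (len A w)) then + K i else + 0

  weakMult-term : ∀ v w u i (d : Dec (_≈_ A u (i ∷ v))) →
                  (if does (_≈?_ A v (i ∷ u)) ∧ does (len A (i ∷ u) ℕ.≟ suc (len A u)) then + K i else + 0) * mS u w
                  ≡ (if does d then downWeight v i * mS (i ∷ v) w else + 0)
  weakMult-term v w u i (yes u≈iv) = cong₂ _*_ weight≡ (mS-resp {u} {w} {i ∷ v} {w} (mk≃ u≈iv) ≃-refl)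
    where
    iu≃v : i ∷ u ≃ v
    iu≃v = ≃-trans (≃-∷ i (mk≃ u≈iv)) (ii∷≃ i v)
    weight≡ : (if does (_≈?_ A v (i ∷ u)) ∧ does (len A (i ∷ u) ℕ.≟ suc (len A u)) then + K i else + 0) ≡ downWeight v i
    weight≡ = cong₂ (λ a b → if a ∧ b then + K i else + 0) (dec-true (_≈?_ A v (i ∷ u)) (un≃ (≃-sym iu≃v)))
                (cong₂ (λ a b → does (a ℕ.≟ b)) (ℓ-cong iu≃v) (cong suc (ℓ-cong (mk≃ {u} {i ∷ v} u≈iv))))
  weakMult-term v w u i (no u≉iv) =
    trans (cong (λ a → (if a ∧ does (len A (i ∷ u) ℕ.≟ suc (len A u)) then + K i else + 0) * mS u w) (dec-false (_≈?_ A v (i ∷ u)) v≉iu))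
          (ℤP.*-zeroˡ (mS u w))
    where
    v≉iu : ¬ _≈_ A v (i ∷ u)
    v≉iu v≈iu = u≉iv (un≃ (≃-trans (≃-sym (ii∷≃ i u)) (≃-∷ i (≃-sym (mk≃ {v} {i ∷ u} v≈iu)))))

  coefUD≡Σ : ∀ v w → coefUD A mS K v w ≡ Σ[ n ] (λ i → downWeight v i * mS (i ∷ v) w)
  coefUD≡Σ v w = begin
      sumℤ (List.map (λ u → weakMult A K u v * mS u w) B)
    ≡⟨ sumℤ-map-cong B (λ u → sym (Σ-*ʳ (mS u w) (term u))) ⟩
      sumℤ (List.map (λ u → Σ[ n ] (λ i → term u i * mS u w)) B)
    ≡⟨ sumℤ-Σ-comm B (λ u i → term u i * mS u w) ⟩
      Σ[ n ] (λ i → sumℤ (List.map (λ u → term u i * mS u w) B))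
    ≡⟨ Σ-cong (λ i → trans (sumℤ-map-cong B (λ u → weakMult-term v w u i (_≈?_ A u (i ∷ v)))) (below i)) ⟩
      Σ[ n ] (λ i → downWeight v i * mS (i ∷ v) w)
    ∎ where
      open ≡-Reasoning
      B = elemsBelow A v
      term : Word n → Fin n → ℤ
      term u i = if does (_≈?_ A v (i ∷ u)) ∧ does (len A (i ∷ u) ℕ.≟ suc (len A u)) then + K i else + 0
      not-descent : ∀ i → ¬ ℓ v ≡ suc (ℓ (i ∷ v)) → downWeight v i * mS (i ∷ v) w ≡ + 0
      not-descent i ¬descent = trans (cong (λ a → (if a then + K i else + 0) * mS (i ∷ v) w)
                                           (dec-false (len A v ℕ.≟ suc (len A (i ∷ v))) ¬descent))
                                     (ℤP.*-zeroˡ (mS (i ∷ v) w))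
      below : ∀ i → sumWhere (λ _ → downWeight v i * mS (i ∷ v) w) (i ∷ v) B ≡ downWeight v i * mS (i ∷ v) w
      below i with elemsBelow-view v
      ... | inj₁ (ℓv≡0 , B≡[]) rewrite B≡[] = sym (not-descent i (λ e → ℕP.1+n≢0 (trans (sym e) ℓv≡0)))
      ... | inj₂ (m , ℓv≡ , B≡) rewrite B≡ = sumWhere-elemsOfLength m (λ _ → downWeight v i * mS (i ∷ v) w) (i ∷ v) (λ _ → refl)
                                                (λ ℓiv≢m → not-descent i (λ e → ℓiv≢m (ℕP.suc-injective (trans (sym e) ℓv≡))))

  diagonal-term : ∀ v i → mS v (i ∷ v) * upWeight v i - downWeight v i * mS (i ∷ v) v ≡ + K i * edgeWeight v i
  diagonal-term v i with ℓ-∷ i v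
  ... | inj₁ ascent = begin
      mS v (i ∷ v) * upWeight v i - downWeight v i * mS (i ∷ v) v
    ≡⟨ cong₂ (λ a b → a * (if b then + K i else + 0) - (if c then + K i else + 0) * mS (i ∷ v) v)
             (mS-edge (ascent-edge v i ascent)) (dec-true (len A (i ∷ v) ℕ.≟ suc (len A v)) ascent) ⟩
      edgeWeight v i * + K i - (if c then + K i else + 0) * mS (i ∷ v) v
    ≡⟨ cong (λ a → edgeWeight v i * + K i - (if a then + K i else + 0) * mS (i ∷ v) v)
            (dec-false (len A v ℕ.≟ suc (len A (i ∷ v))) (λ e → 2+n≰n (ℕP.≤-reflexive (sym (trans e (cong suc ascent)))))) ⟩
      edgeWeight v i * + K i - + 0 * mS (i ∷ v) v
    ≡⟨ solve 3 (λ m k x → m :* k :- con (+ 0) :* x := k :* m) refl (edgeWeight v i) (+ K i) (mS (i ∷ v) v) ⟩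
      + K i * edgeWeight v i
    ∎ where
      open ≡-Reasoning
      c = does (len A v ℕ.≟ suc (len A (i ∷ v)))
  ... | inj₂ descent = begin
      mS v (i ∷ v) * upWeight v i - downWeight v i * mS (i ∷ v) v
    ≡⟨ cong₂ (λ a b → mS v (i ∷ v) * (if a then + K i else + 0) - (if b then + K i else + 0) * mS (i ∷ v) v)
         (dec-false (len A (i ∷ v) ℕ.≟ suc (len A v)) (λ e → 2+n≰n (ℕP.≤-reflexive (trans (cong suc (sym e)) descent))))
         (dec-true (len A v ℕ.≟ suc (len A (i ∷ v))) (sym descent)) ⟩
      mS v (i ∷ v) * + 0 - + K i * mS (i ∷ v) v
    ≡⟨ cong (λ a → mS v (i ∷ v) * + 0 - + K i * a) (mS-edge (descent-edge v i descent)) ⟩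
      mS v (i ∷ v) * + 0 - + K i * (- edgeWeight v i)
    ≡⟨ solve 3 (λ s k m → s :* con (+ 0) :- k :* (:- m) := k :* m) refl (mS v (i ∷ v)) (+ K i) (edgeWeight v i) ⟩
      + K i * edgeWeight v i
    ∎ where open ≡-Reasoning

  off-diagonal-term : ∀ v w i → ¬ v ≃ w → (iw-ascent? : Dec (ℓ (i ∷ w) ≡ suc (ℓ w))) (iv-descent? : Dec (ℓ v ≡ suc (ℓ (i ∷ v)))) →
                      mS v (i ∷ w) * (if does iw-ascent? then + K i else + 0) ≡ (if does iv-descent? then + K i else + 0) * mS (i ∷ v) w
  off-diagonal-term v w i v≄w (yes iw-ascent) (yes iv-descent) = trans (cong (_* + K i) mS≡) (ℤP.*-comm (mS (i ∷ v) w) (+ K i))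
    where
    mS≡ : mS v (i ∷ w) ≡ mS (i ∷ v) w
    mS≡ with isMult v (i ∷ w)
    ... | inj₁ e = sym (mS-edge (edge-shift {v} {w} {i} iw-ascent iv-descent e))
    ... | inj₂ (no-edge , mS≡0) = trans mS≡0 (sym (mS-no-edge (i ∷ v) w (λ m e → no-edge (m , edge-unshift {v} {w} {i} iw-ascent iv-descent e))))
  off-diagonal-term v w i v≄w (yes iw-ascent) (no ¬iv-descent) = trans (cong (_* + K i) mS≡0) (trans (ℤP.*-zeroˡ (+ K i)) (sym (ℤP.*-zeroˡ (mS (i ∷ v) w))))
    where
    iv-ascent : ℓ (i ∷ v) ≡ suc (ℓ v)
    iv-ascent with ℓ-∷ i v
    ... | inj₁ ascent = ascent
    ... | inj₂ descent = ⊥-elim (¬iv-descent (sym descent))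
    mS≡0 : mS v (i ∷ w) ≡ + 0
    mS≡0 = mS-no-edge v (i ∷ w) (no-edge-to-ascent v w i v≄w iv-ascent iw-ascent)
  off-diagonal-term v w i v≄w (no ¬iw-ascent) (yes iv-descent) = trans (ℤP.*-zeroʳ (mS v (i ∷ w))) (sym (trans (cong (+ K i *_) mS≡0) (ℤP.*-zeroʳ (+ K i))))
    where
    iw-descent : suc (ℓ (i ∷ w)) ≡ ℓ w
    iw-descent with ℓ-∷ i w
    ... | inj₁ ascent = ⊥-elim (¬iw-ascent ascent)
    ... | inj₂ descent = descent
    mS≡0 : mS (i ∷ v) w ≡ + 0
    mS≡0 = mS-no-edge (i ∷ v) w (no-edge-from-descent v w i v≄w (sym iv-descent) iw-descent)
  off-diagonal-term v w i v≄w (no _) (no _) = trans (ℤP.*-zeroʳ (mS v (i ∷ w))) (sym (ℤP.*-zeroˡ (mS (i ∷ v) w)))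

  commutator-Σ : ∀ v w → (d : Dec (_≈_ A v w)) →
                 Σ[ n ] (λ i → mS v (i ∷ w) * upWeight w i) - Σ[ n ] (λ i → downWeight v i * mS (i ∷ v) w)
                 ≡ pairKΛ A K Λ * (if does d then + 1 else + 0)
  commutator-Σ v w (yes v≈w) = begin
      Σ[ n ] (λ i → mS v (i ∷ w) * upWeight w i) - Σ[ n ] (λ i → downWeight v i * mS (i ∷ v) w)
    ≡⟨ sym (Σ-distrib-- (λ i → mS v (i ∷ w) * upWeight w i) (λ i → downWeight v i * mS (i ∷ v) w)) ⟩
      Σ[ n ] (λ i → mS v (i ∷ w) * upWeight w i - downWeight v i * mS (i ∷ v) w)
    ≡⟨ Σ-cong (λ i → cong₂ (λ a b → a - downWeight v i * b)
                           (cong₂ _*_ (mS-resp ≃-refl (≃-∷ i w≃v)) (upWeight-resp i)) (mS-resp ≃-refl w≃v)) ⟩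
      Σ[ n ] (λ i → mS v (i ∷ v) * upWeight v i - downWeight v i * mS (i ∷ v) v)
    ≡⟨ Σ-cong (diagonal-term v) ⟩
      Σ[ n ] (λ i → + K i * edgeWeight v i)
    ≡⟨ Σ-K-edgeWeight K central v ⟩
      pairKΛ A K Λ
    ≡⟨ sym (ℤP.*-identityʳ (pairKΛ A K Λ)) ⟩
      pairKΛ A K Λ * + 1
    ∎ where
      open ≡-Reasoning
      w≃v : w ≃ v
      w≃v = ≃-sym (mk≃ v≈w)
      upWeight-resp : ∀ i → upWeight w i ≡ upWeight v i
      upWeight-resp i = cong₂ (λ a b → if does (a ℕ.≟ suc b) then + K i else + 0) (ℓ-cong (≃-∷ i w≃v)) (ℓ-cong w≃v)
  commutator-Σ v w (no v≉w) = begin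
      Σ[ n ] (λ i → mS v (i ∷ w) * upWeight w i) - Σ[ n ] (λ i → downWeight v i * mS (i ∷ v) w)
    ≡⟨ cong (_- Σ[ n ] (λ i → downWeight v i * mS (i ∷ v) w)) (Σ-cong (λ i → off-diagonal-term v w i (v≉w ∘ un≃) (_ ℕ.≟ _) (_ ℕ.≟ _))) ⟩
      Σ[ n ] (λ i → downWeight v i * mS (i ∷ v) w) - Σ[ n ] (λ i → downWeight v i * mS (i ∷ v) w)
    ≡⟨ ℤP.+-inverseʳ (Σ[ n ] (λ i → downWeight v i * mS (i ∷ v) w)) ⟩
      + 0
    ≡⟨ sym (ℤP.*-zeroʳ (pairKΛ A K Λ)) ⟩
      pairKΛ A K Λ * + 0
    ∎ where open ≡-Reasoning

theorem2p3 : ∀ {n : ℕ} (A : GCM n) (Λ : Fin n → ℕ) (K : Fin n → ℕ) →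
    IsCentral A K →
    (mS : Word n → Word n → ℤ) → IsStrongMult A Λ mS →
    ∀ (v w : Word n) →
      coefDU A mS K v w - coefUD A mS K v w ≡ pairKΛ A K Λ * idCoef A v w
theorem2p3 A Λ K central mS isMult v w = begin
    coefDU A mS K v w - coefUD A mS K v w
  ≡⟨ cong₂ _-_ (coefDU≡Σ v w) (coefUD≡Σ v w) ⟩
    Σ[ _ ] (λ i → mS v (i ∷ w) * upWeight w i) - Σ[ _ ] (λ i → downWeight v i * mS (i ∷ v) w)
  ≡⟨ commutator-Σ v w (_≈?_ A v w) ⟩
    pairKΛ A K Λ * idCoef A v w
  ∎
  where
  open ≡-Reasoning
  open DualGraded A Λ K central mS isMult
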